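{- The following sets $\mathcal{S}$ are optimal $(1,\mu)$-saturating sets in $PG(2,q)$: (i) $\mathcal{S}$ is the union of $L$ concurrent lines, $2\le L\le q$; then $|\mathcal{S}|=1+Lq$ and $\mu=\binom L2 q$. (ii) $\mathcal{S}$ is the union of $q$ lines through a common point $G$ together with $b$ further points, $1\le b\le q-1$, lying on the remaining $(q+1)$-th line through $G$ (and different from $G$); then $|\mathcal{S}|=1+q^2+b$ and $\mu=\binom{b+1}{2}+\binom q2 q$. (iii) $\mathcal{S}$ is a triangle, i.e. the union of three non-concurrent lines; then $|\mathcal{S}|=3q$ and $\mu=3(q-1)$. (iv) $\mathcal{S}=PG(2,q)\setminus T$, where $T$ is a vertex-less triangle; then $|\mathcal{S}|=q^2-2q+4$ and $\mu=1+\binom q2+(q-1)\binom{q-2}{2}$.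
   Context: A vertex-less triangle is the union of three non-concurrent lines with their three pairwise intersection points (the vertices) removed; it has $3(q-1)$ points. For a set $S$ of points in $PG(2,q)$ and a line $\ell$, the multiplicity of $\ell$ is $\binom{|\ell\cap S|}{2}$; a secant is a line with $|\ell\cap S|\ge2$. A set $S$ is $(1,\mu)$-saturating if it spans $PG(2,q)$, $S\ne PG(2,q)$, and every point $Q\notin S$ lies on secants of $S$ whose multiplicities sum to at least $\mu$; it is optimal if this sum equals $\mu$ exactly for every point $Q\notin S$. -}

module Defs where

open import Data.Nat using (ℕ; zero; suc; _+_; _*_; _∸_; _≤_)
open import Data.Nat.Combinatorics using (_C_)
open import Data.Bool using (Bool; true; false; _∧_; _∨_; not)
open import Data.List using (List; []; _∷_; length; filter; map; concatMap)
open import Data.Nat.ListAction using (sum)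
open import Data.Bool.ListAction using (any)
open import Data.List.Membership.Propositional using (_∈_)
open import Data.List.Relation.Unary.Unique.Propositional using (Unique)
open import Data.Product using (Σ; _×_; _,_)
open import Relation.Nullary using (¬_; Dec; yes; no)
open import Relation.Nullary.Decidable using (⌊_⌋)
open import Relation.Binary.Definitions using (DecidableEquality)
open import Relation.Binary.PropositionalEquality using (_≡_; _≢_; refl)
open import Algebra.Structures using (IsCommutativeRing)

record FiniteField : Set₁ where
  field
    Carrier : Set
    _+F_ : Carrier → Carrier → Carrier
    _*F_ : Carrier → Carrier → Carrier
    -F_  : Carrier → Carrier
    0F 1F : Carrier
    inv : Carrier → Carrier
    isCommutativeRing : IsCommutativeRing _≡_ _+F_ _*F_ -F_ 0F 1F
    0≢1 : 0F ≢ 1F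
    inverse : ∀ x → x ≢ 0F → x *F inv x ≡ 1F
    _≟F_ : DecidableEquality Carrier
    elems : List Carrier
    elems-complete : ∀ x → x ∈ elems
    elems-unique : Unique elems

-- The projective plane PG(2,q) over a finite field K.
-- Points (and dually lines) are represented by their unique normalised
-- homogeneous coordinates: (1,x,y), (0,1,x), (0,0,1).

module PG (K : FiniteField) where
  open FiniteField K

  q : ℕ
  q = length elems

  data Point : Set where
    p₁ : Carrier → Carrier → Point
    p₂ : Carrier → Point
    p₃ : Point

  data Line : Set where
    l₁ : Carrier → Carrier → Line
    l₂ : Carrier → Line
    l₃ : Line

  record Triple : Set where
    constructor ⟨_,_,_⟩
    field c₀ c₁ c₂ : Carrier

  pcoords : Point → Triple
  pcoords (p₁ x y) = ⟨ 1F , x , y ⟩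
  pcoords (p₂ x)   = ⟨ 0F , 1F , x ⟩
  pcoords p₃       = ⟨ 0F , 0F , 1F ⟩

  lcoords : Line → Triple
  lcoords (l₁ x y) = ⟨ 1F , x , y ⟩
  lcoords (l₂ x)   = ⟨ 0F , 1F , x ⟩
  lcoords l₃       = ⟨ 0F , 0F , 1F ⟩

  dot : Triple → Triple → Carrier
  dot ⟨ a , b , c ⟩ ⟨ x , y , z ⟩ = ((a *F x) +F (b *F y)) +F (c *F z)

  Incident : Point → Line → Set
  Incident P ℓ = dot (pcoords P) (lcoords ℓ) ≡ 0F

  incident? : Point → Line → Bool
  incident? P ℓ = ⌊ dot (pcoords P) (lcoords ℓ) ≟F 0F ⌋

  _≟P_ : DecidableEquality Point
  p₁ x y ≟P p₁ x' y' with x ≟F x' | y ≟F y'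
  ... | yes refl | yes refl = yes refl
  ... | no ¬p | _ = no λ { refl → ¬p refl }
  ... | yes _ | no ¬p = no λ { refl → ¬p refl }
  p₁ _ _ ≟P p₂ _ = no λ ()
  p₁ _ _ ≟P p₃ = no λ ()
  p₂ _ ≟P p₁ _ _ = no λ ()
  p₂ x ≟P p₂ x' with x ≟F x'
  ... | yes refl = yes refl
  ... | no ¬p = no λ { refl → ¬p refl }
  p₂ _ ≟P p₃ = no λ ()
  p₃ ≟P p₁ _ _ = no λ ()
  p₃ ≟P p₂ _ = no λ ()
  p₃ ≟P p₃ = yes refl

  allPoints : List Point
  allPoints = concatMap (λ x → map (p₁ x) elems) elems
              Data.List.++ (map p₂ elems Data.List.++ (p₃ ∷ []))

  allLines : List Line
  allLines = concatMap (λ x → map (l₁ x) elems) elems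
             Data.List.++ (map l₂ elems Data.List.++ (l₃ ∷ []))

  PointSet : Set
  PointSet = Point → Bool

  _∈S_ : Point → PointSet → Set
  P ∈S S = S P ≡ true

  size : PointSet → ℕ
  size S = length (filter (λ P → S P Data.Bool.≟ true) allPoints)

  meet : PointSet → Line → ℕ
  meet S ℓ = length (filter (λ P → (S P ∧ incident? P ℓ) Data.Bool.≟ true) allPoints)

  multiplicity : PointSet → Line → ℕ
  multiplicity S ℓ = meet S ℓ C 2

  secantSum : PointSet → Point → ℕ
  secantSum S Q =
    sum (map (multiplicity S)
             (filter (λ ℓ → 2 Data.Nat.≤? meet S ℓ)
                     (filter (λ ℓ → incident? Q ℓ Data.Bool.≟ true) allLines)))

  -- S spans PG(2,q): the subspaces of PG(2,q) are ∅, points, lines and the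
  -- whole plane, so S spans the plane iff S is contained in no line.
  Spans : PointSet → Set
  Spans S = ¬ Σ Line (λ ℓ → ∀ P → P ∈S S → Incident P ℓ)

  IsSaturating : PointSet → ℕ → Set
  IsSaturating S μ =
    Spans S × (¬ (∀ P → P ∈S S)) × (∀ Q → S Q ≡ false → μ ≤ secantSum S Q)

  IsOptimalSaturating : PointSet → ℕ → Set
  IsOptimalSaturating S μ =
    IsSaturating S μ × (∀ Q → S Q ≡ false → secantSum S Q ≡ μ)

  unionOfLines : List Line → PointSet
  unionOfLines ls P = any (incident? P) ls

  inList : List Point → Point → Bool
  inList B P = any (λ R → ⌊ P ≟P R ⌋) B

  NonConcurrent : Line → Line → Line → Set
  NonConcurrent ℓ₁ ℓ₂ ℓ₃ = ¬ Σ Point (λ P → Incident P ℓ₁ × Incident P ℓ₂ × Incident P ℓ₃)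

  triangle : Line → Line → Line → PointSet
  triangle ℓ₁ ℓ₂ ℓ₃ = unionOfLines (ℓ₁ ∷ ℓ₂ ∷ ℓ₃ ∷ [])

  isVertex : Line → Line → Line → PointSet
  isVertex ℓ₁ ℓ₂ ℓ₃ P =
    (incident? P ℓ₁ ∧ incident? P ℓ₂) ∨ (incident? P ℓ₁ ∧ incident? P ℓ₃)
      ∨ (incident? P ℓ₂ ∧ incident? P ℓ₃)

  vertexlessTriangle : Line → Line → Line → PointSet
  vertexlessTriangle ℓ₁ ℓ₂ ℓ₃ P = triangle ℓ₁ ℓ₂ ℓ₃ P ∧ not (isVertex ℓ₁ ℓ₂ ℓ₃ P)

-- All four sets are analysed in an arbitrary finite projective plane of order q, using only
-- that two lines meet in one point, two points lie on one line, and every line and every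
-- pencil has q + 1 elements; PG(2,K) is such a plane, two lines meeting in the point given by
-- the cross product of their coordinates. For Q ∉ S, all but at most three lines through Q
-- meet S in the same number c of points (c = L, q, 3, q − 2 in cases (i)–(iv)). The exceptional
-- lines are the line QG in (i), the line m in (ii), the joins of Q with the three vertices in
-- (iii), and in (iv) the side through Q and the join of Q with the opposite vertex; their
-- intersections with S follow from inclusion–exclusion over the sides. Summing binom(|ℓ ∩ S|, 2)
-- over the pencil of Q gives μ.
module Submission where

open import Defs
open import Algebra.Bundles using (CommutativeRing)
open import Algebra.Structures using (IsCommutativeRing)
open import Algebra.Solver.Ring.AlmostCommutativeRing using (fromCommutativeRing; _-Raw-AlmostCommutative⟶_; Induced-equivalence)
open import Data.Bool using (Bool; true; false; _∧_; _∨_; not; if_then_else_)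
import Data.Bool as Bool
import Data.Bool.Properties as Bool
open import Data.Bool.ListAction using (any)
open import Data.Empty using (⊥; ⊥-elim)
open import Data.Integer as ℤ using (ℤ; -[1+_]; _⊖_; 0ℤ; 1ℤ)
import Data.Integer.Properties as ℤ
open import Data.List using (List; []; _∷_; length; filter; map; concatMap; _++_; cartesianProductWith)
open import Data.List.Membership.Propositional using (_∈_; _∉_)
open import Data.List.Membership.Propositional.Properties
  using (∈-map⁺; ∈-map⁻; ∈-++⁺ˡ; ∈-++⁺ʳ; ∈-++⁻; ∈-cartesianProductWith⁺; ∈-cartesianProductWith⁻)
import Data.List.Properties as List
open import Data.List.Relation.Unary.All as All using (All; []; _∷_)
open import Data.List.Relation.Unary.All.Properties using (¬Any⇒All¬)
open import Data.List.Relation.Unary.Any using (here; there)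
open import Data.List.Relation.Unary.AllPairs using ([]; _∷_)
open import Data.List.Relation.Unary.Unique.Propositional using (Unique)
import Data.List.Relation.Unary.Unique.Propositional.Properties as Unique
open import Data.Maybe using (just; nothing)
open import Data.Nat using (ℕ; zero; suc; _+_; _*_; _∸_; _≤_; _<_; _^_; z≤n; s≤s)
import Data.Nat as ℕ
import Data.Nat.Properties as ℕ
open import Data.Nat.Combinatorics using (_C_)
open import Data.Nat.ListAction using (sum)
open import Data.Nat.Tactic.RingSolver using (solve-∀)
open import Data.Product using (Σ; _×_; _,_; proj₁; proj₂)
open import Data.Sum using (_⊎_; inj₁; inj₂)
open import Relation.Binary.Definitions using (DecidableEquality; WeaklyDecidable)
open import Relation.Binary.PropositionalEquality
open import Relation.Nullary using (¬_; Dec; yes; no)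
open import Relation.Nullary.Decidable using (⌊_⌋)

-- Boolean predicates and counting

toℕ : Bool → ℕ
toℕ true = 1
toℕ false = 0

anyOf₃ : Bool → Bool → Bool → Bool
anyOf₃ a b c = a ∨ (b ∨ (c ∨ false))

anyOf₃-false : ∀ {a b c} → anyOf₃ a b c ≡ false → a ≡ false × b ≡ false × c ≡ false
anyOf₃-false {false} {false} {false} _ = refl , refl , refl

exactlyOne : Bool → Bool → Bool → Bool
exactlyOne a b c = anyOf₃ a b c ∧ not ((a ∧ b) ∨ (a ∧ c) ∨ (b ∧ c))

exactlyOne-swap : ∀ a b c → exactlyOne b a c ≡ exactlyOne a b c
exactlyOne-swap true  true  true  = refl
exactlyOne-swap true  true  false = refl
exactlyOne-swap true  false true  = refl
exactlyOne-swap true  false false = refl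
exactlyOne-swap false true  true  = refl
exactlyOne-swap false true  false = refl
exactlyOne-swap false false true  = refl
exactlyOne-swap false false false = refl

exactlyOne-rotate : ∀ a b c → exactlyOne b c a ≡ exactlyOne a b c
exactlyOne-rotate true  true  true  = refl
exactlyOne-rotate true  true  false = refl
exactlyOne-rotate true  false true  = refl
exactlyOne-rotate true  false false = refl
exactlyOne-rotate false true  true  = refl
exactlyOne-rotate false true  false = refl
exactlyOne-rotate false false true  = refl
exactlyOne-rotate false false false = refl

exactlyOne-cases : ∀ a b c → exactlyOne a b c ≡ true →
  (a ≡ true × b ≡ false × c ≡ false) ⊎ (a ≡ false × b ≡ true × c ≡ false) ⊎ (a ≡ false × b ≡ false × c ≡ true)
exactlyOne-cases true  false false _ = inj₁ (refl , refl , refl)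
exactlyOne-cases false true  false _ = inj₂ (inj₁ (refl , refl , refl))
exactlyOne-cases false false true  _ = inj₂ (inj₂ (refl , refl , refl))

∧-true : ∀ {a b} → a ∧ b ≡ true → a ≡ true × b ≡ true
∧-true {true} e = refl , e

∧-intro : ∀ {a b} → a ≡ true → b ≡ true → a ∧ b ≡ true
∧-intro refl refl = refl

∨-false : ∀ {a b} → a ∨ b ≡ false → a ≡ false × b ≡ false
∨-false {false} e = refl , e

not-true : ∀ {a} → not a ≡ true → a ≡ false
not-true {false} _ = refl

not-false : ∀ {a} → not a ≡ false → a ≡ true
not-false {true} _ = refl

false-if-not-true : ∀ {a} → (a ≡ true → ⊥) → a ≡ false
false-if-not-true {true} h = ⊥-elim (h refl)
false-if-not-true {false} _ = refl

true-if-not-false : ∀ {a} → (a ≡ false → ⊥) → a ≡ true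
true-if-not-false {true} _ = refl
true-if-not-false {false} h = ⊥-elim (h refl)

true≢false : ∀ {a} → a ≡ true → a ≡ false → ⊥
true≢false refl ()

square : ∀ n → n ^ 2 ≡ n * n
square n = cong (n *_) (ℕ.*-identityʳ n)

module _ {A : Set} where

  infixr 7 _∩_

  _∩_ : (A → Bool) → (A → Bool) → A → Bool
  (p ∩ r) x = p x ∧ r x

  ∁ : (A → Bool) → A → Bool
  ∁ p x = not (p x)

  count : (A → Bool) → List A → ℕ
  count p xs = length (filter (λ x → p x Bool.≟ true) xs)

  sumWhere : (A → ℕ) → (A → Bool) → List A → ℕ
  sumWhere f p xs = sum (map f (filter (λ x → p x Bool.≟ true) xs))

  count-∷ : ∀ p x xs → count p (x ∷ xs) ≡ toℕ (p x) + count p xs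
  count-∷ p x xs with p x Bool.≟ true
  ... | yes e rewrite e = refl
  ... | no ne with p x
  ... | true = ⊥-elim (ne refl)
  ... | false = refl

  sumWhere-∷ : ∀ f p x xs → sumWhere f p (x ∷ xs) ≡ (if p x then f x else 0) + sumWhere f p xs
  sumWhere-∷ f p x xs with p x Bool.≟ true
  ... | yes e rewrite e = refl
  ... | no ne with p x
  ... | true = ⊥-elim (ne refl)
  ... | false = refl

  count-++ : ∀ p xs ys → count p (xs ++ ys) ≡ count p xs + count p ys
  count-++ p [] ys = refl
  count-++ p (x ∷ xs) ys = begin
    count p (x ∷ xs ++ ys)                   ≡⟨ count-∷ p x (xs ++ ys) ⟩
    toℕ (p x) + count p (xs ++ ys)           ≡⟨ cong (toℕ (p x) +_) (count-++ p xs ys) ⟩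
    toℕ (p x) + (count p xs + count p ys)    ≡⟨ ℕ.+-assoc (toℕ (p x)) _ _ ⟨
    (toℕ (p x) + count p xs) + count p ys    ≡⟨ cong (_+ count p ys) (count-∷ p x xs) ⟨
    count p (x ∷ xs) + count p ys            ∎
    where open ≡-Reasoning

  count-cong : ∀ p r xs → (∀ x → p x ≡ r x) → count p xs ≡ count r xs
  count-cong p r [] e = refl
  count-cong p r (x ∷ xs) e = begin
    count p (x ∷ xs)            ≡⟨ count-∷ p x xs ⟩
    toℕ (p x) + count p xs      ≡⟨ cong₂ (λ b n → toℕ b + n) (e x) (count-cong p r xs e) ⟩
    toℕ (r x) + count r xs      ≡⟨ count-∷ r x xs ⟨
    count r (x ∷ xs)            ∎
    where open ≡-Reasoning

  count-none : ∀ p xs → (∀ x → p x ≡ false) → count p xs ≡ 0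
  count-none p [] e = refl
  count-none p (x ∷ xs) e = trans (count-∷ p x xs) (cong₂ (λ b n → toℕ b + n) (e x) (count-none p xs e))

  count-all : ∀ p xs → (∀ x → p x ≡ true) → count p xs ≡ length xs
  count-all p [] e = refl
  count-all p (x ∷ xs) e = trans (count-∷ p x xs) (cong₂ (λ b n → toℕ b + n) (e x) (count-all p xs e))

  count-mono : ∀ p r xs → (∀ x → p x ≡ true → r x ≡ true) → count p xs ≤ count r xs
  count-mono p r [] h = z≤n
  count-mono p r (x ∷ xs) h rewrite count-∷ p x xs | count-∷ r x xs =
    ℕ.+-mono-≤ (toℕ-mono (p x) (r x) (h x)) (count-mono p r xs h)
    where
    toℕ-mono : ∀ a b → (a ≡ true → b ≡ true) → toℕ a ≤ toℕ b
    toℕ-mono true b f rewrite f refl = ℕ.≤-refl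
    toℕ-mono false b f = z≤n

  count-witness : ∀ p xs → 1 ≤ count p xs → Σ A (λ x → p x ≡ true)
  count-witness p (x ∷ xs) h with p x in e | subst (1 ≤_) (count-∷ p x xs) h
  ... | true | _ = x , e
  ... | false | h′ = count-witness p xs h′

  infixr 6 _∪_

  _∪_ : (A → Bool) → (A → Bool) → A → Bool
  (p ∪ r) x = p x ∨ r x

  count-∪+count-∩ : ∀ p r xs → count (p ∪ r) xs + count (p ∩ r) xs ≡ count p xs + count r xs
  count-∪+count-∩ p r [] = refl
  count-∪+count-∩ p r (x ∷ xs) = begin
    count (p ∪ r) (x ∷ xs) + count (p ∩ r) (x ∷ xs)
      ≡⟨ cong₂ _+_ (count-∷ (p ∪ r) x xs) (count-∷ (p ∩ r) x xs) ⟩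
    (toℕ (p x ∨ r x) + count (p ∪ r) xs) + (toℕ (p x ∧ r x) + count (p ∩ r) xs)
      ≡⟨ interchange (toℕ (p x ∨ r x)) _ _ _ ⟩
    (toℕ (p x ∨ r x) + toℕ (p x ∧ r x)) + (count (p ∪ r) xs + count (p ∩ r) xs)
      ≡⟨ cong₂ _+_ (pointwise (p x) (r x)) (count-∪+count-∩ p r xs) ⟩
    (toℕ (p x) + toℕ (r x)) + (count p xs + count r xs)
      ≡⟨ interchange (toℕ (p x)) _ _ _ ⟩
    (toℕ (p x) + count p xs) + (toℕ (r x) + count r xs)
      ≡⟨ cong₂ _+_ (count-∷ p x xs) (count-∷ r x xs) ⟨
    count p (x ∷ xs) + count r (x ∷ xs) ∎
    where
    open ≡-Reasoning
    interchange : ∀ a b c d → (a + b) + (c + d) ≡ (a + c) + (b + d)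
    interchange = solve-∀
    pointwise : ∀ a b → toℕ (a ∨ b) + toℕ (a ∧ b) ≡ toℕ a + toℕ b
    pointwise true  true  = refl
    pointwise true  false = refl
    pointwise false true  = refl
    pointwise false false = refl

  count-split : ∀ p r xs → count p xs ≡ count (p ∩ r) xs + count (p ∩ ∁ r) xs
  count-split p r [] = refl
  count-split p r (x ∷ xs) = begin
    count p (x ∷ xs)
      ≡⟨ count-∷ p x xs ⟩
    toℕ (p x) + count p xs
      ≡⟨ cong₂ _+_ (pointwise (p x) (r x)) (count-split p r xs) ⟩
    (toℕ (p x ∧ r x) + toℕ (p x ∧ not (r x))) + (count (p ∩ r) xs + count (p ∩ ∁ r) xs)
      ≡⟨ interchange (toℕ (p x ∧ r x)) _ _ _ ⟩
    (toℕ (p x ∧ r x) + count (p ∩ r) xs) + (toℕ (p x ∧ not (r x)) + count (p ∩ ∁ r) xs)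
      ≡⟨ cong₂ _+_ (count-∷ (p ∩ r) x xs) (count-∷ (p ∩ ∁ r) x xs) ⟨
    count (p ∩ r) (x ∷ xs) + count (p ∩ ∁ r) (x ∷ xs) ∎
    where
    open ≡-Reasoning
    interchange : ∀ a b c d → (a + b) + (c + d) ≡ (a + c) + (b + d)
    interchange = solve-∀
    pointwise : ∀ a b → toℕ a ≡ toℕ (a ∧ b) + toℕ (a ∧ not b)
    pointwise true  true  = refl
    pointwise true  false = refl
    pointwise false true  = refl
    pointwise false false = refl

  count+count-∁ : ∀ p xs → count p xs + count (∁ p) xs ≡ length xs
  count+count-∁ p xs = trans (sym (count-split (λ _ → true) p xs)) (count-all (λ _ → true) xs (λ _ → refl))

  Σcount : List (A → Bool) → List A → ℕ
  Σcount ps xs = sum (map (λ p → count p xs) ps)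

  Σtoℕ : List (A → Bool) → A → ℕ
  Σtoℕ ps x = sum (map (λ p → toℕ (p x)) ps)

  Σcount-∷ : ∀ ps x xs → Σcount ps (x ∷ xs) ≡ Σtoℕ ps x + Σcount ps xs
  Σcount-∷ [] x xs = refl
  Σcount-∷ (p ∷ ps) x xs =
    trans (cong₂ _+_ (count-∷ p x xs) (Σcount-∷ ps x xs)) (interchange (toℕ (p x)) (count p xs) (Σtoℕ ps x) (Σcount ps xs))
    where
    interchange : ∀ a b c d → (a + b) + (c + d) ≡ (a + c) + (b + d)
    interchange = solve-∀

  Σcount-linear : ∀ ps rs xs → (∀ x → Σtoℕ ps x ≡ Σtoℕ rs x) → Σcount ps xs ≡ Σcount rs xs
  Σcount-linear ps rs [] h = trans (Σcount-[] ps) (sym (Σcount-[] rs))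
    where
    Σcount-[] : ∀ ps → Σcount ps [] ≡ 0
    Σcount-[] [] = refl
    Σcount-[] (_ ∷ ps) = Σcount-[] ps
  Σcount-linear ps rs (x ∷ xs) h =
    trans (Σcount-∷ ps x xs) (trans (cong₂ _+_ (h x) (Σcount-linear ps rs xs h)) (sym (Σcount-∷ rs x xs)))

  inclusion-exclusion₃ : ∀ (d a b c : A → Bool) xs →
    Σcount (d ∩ (λ x → anyOf₃ (a x) (b x) (c x)) ∷ d ∩ a ∩ b ∷ d ∩ a ∩ c ∷ d ∩ b ∩ c ∷ []) xs
      ≡ Σcount (d ∩ a ∷ d ∩ b ∷ d ∩ c ∷ d ∩ a ∩ b ∩ c ∷ []) xs
  inclusion-exclusion₃ d a b c xs =
    Σcount-linear (d ∩ (λ x → anyOf₃ (a x) (b x) (c x)) ∷ d ∩ a ∩ b ∷ d ∩ a ∩ c ∷ d ∩ b ∩ c ∷ [])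
                  (d ∩ a ∷ d ∩ b ∷ d ∩ c ∷ d ∩ a ∩ b ∩ c ∷ []) xs (λ x → pointwise (d x) (a x) (b x) (c x))
    where
    pointwise : ∀ d a b c →
      toℕ (d ∧ anyOf₃ a b c) + (toℕ (d ∧ a ∧ b) + (toℕ (d ∧ a ∧ c) + (toℕ (d ∧ b ∧ c) + 0)))
        ≡ toℕ (d ∧ a) + (toℕ (d ∧ b) + (toℕ (d ∧ c) + (toℕ (d ∧ a ∧ b ∧ c) + 0)))
    pointwise false _ _ _ = refl
    pointwise true true  true  true  = refl
    pointwise true true  true  false = refl
    pointwise true true  false true  = refl
    pointwise true true  false false = refl
    pointwise true false true  true  = refl
    pointwise true false true  false = refl
    pointwise true false false true  = refl
    pointwise true false false false = refl

  exactly-one-exclusion₃ : ∀ (d a b c : A → Bool) xs →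
    Σcount (d ∩ (λ x → exactlyOne (a x) (b x) (c x))
            ∷ d ∩ a ∩ b ∷ d ∩ a ∩ b ∷ d ∩ a ∩ c ∷ d ∩ a ∩ c ∷ d ∩ b ∩ c ∷ d ∩ b ∩ c ∷ []) xs
      ≡ Σcount (d ∩ a ∷ d ∩ b ∷ d ∩ c ∷ d ∩ a ∩ b ∩ c ∷ d ∩ a ∩ b ∩ c ∷ d ∩ a ∩ b ∩ c ∷ []) xs
  exactly-one-exclusion₃ d a b c xs =
    Σcount-linear (d ∩ (λ x → exactlyOne (a x) (b x) (c x))
                     ∷ d ∩ a ∩ b ∷ d ∩ a ∩ b ∷ d ∩ a ∩ c ∷ d ∩ a ∩ c ∷ d ∩ b ∩ c ∷ d ∩ b ∩ c ∷ [])
                  (d ∩ a ∷ d ∩ b ∷ d ∩ c ∷ d ∩ a ∩ b ∩ c ∷ d ∩ a ∩ b ∩ c ∷ d ∩ a ∩ b ∩ c ∷ []) xs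
                  (λ x → pointwise (d x) (a x) (b x) (c x))
    where
    pointwise : ∀ d a b c →
      toℕ (d ∧ exactlyOne a b c) + (toℕ (d ∧ a ∧ b) + (toℕ (d ∧ a ∧ b) + (toℕ (d ∧ a ∧ c) + (toℕ (d ∧ a ∧ c)
        + (toℕ (d ∧ b ∧ c) + (toℕ (d ∧ b ∧ c) + 0))))))
        ≡ toℕ (d ∧ a) + (toℕ (d ∧ b) + (toℕ (d ∧ c)
          + (toℕ (d ∧ a ∧ b ∧ c) + (toℕ (d ∧ a ∧ b ∧ c) + (toℕ (d ∧ a ∧ b ∧ c) + 0)))))
    pointwise false _ _ _ = refl
    pointwise true true  true  true  = refl
    pointwise true true  true  false = refl
    pointwise true true  false true  = refl
    pointwise true true  false false = refl
    pointwise true false true  true  = refl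
    pointwise true false true  false = refl
    pointwise true false false true  = refl
    pointwise true false false false = refl

  sum-map-const : ∀ (f : A → ℕ) c xs → (∀ x → f x ≡ c) → sum (map f xs) ≡ c * length xs
  sum-map-const f c [] e = sym (ℕ.*-zeroʳ c)
  sum-map-const f c (x ∷ xs) e = trans (cong₂ _+_ (e x) (sum-map-const f c xs e)) (sym (ℕ.*-suc c (length xs)))

  sum-map-cong : ∀ (f g : A → ℕ) xs → (∀ x → f x ≡ g x) → sum (map f xs) ≡ sum (map g xs)
  sum-map-cong f g [] e = refl
  sum-map-cong f g (x ∷ xs) e = cong₂ _+_ (e x) (sum-map-cong f g xs e)

  sum-map-scaled-toℕ : ∀ c p xs → sum (map (λ x → c * toℕ (p x)) xs) ≡ c * count p xs
  sum-map-scaled-toℕ c p [] = sym (ℕ.*-zeroʳ c)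
  sum-map-scaled-toℕ c p (x ∷ xs) = begin
    c * toℕ (p x) + sum (map (λ x → c * toℕ (p x)) xs)   ≡⟨ cong (c * toℕ (p x) +_) (sum-map-scaled-toℕ c p xs) ⟩
    c * toℕ (p x) + c * count p xs                       ≡⟨ ℕ.*-distribˡ-+ c (toℕ (p x)) _ ⟨
    c * (toℕ (p x) + count p xs)                         ≡⟨ cong (c *_) (count-∷ p x xs) ⟨
    c * count p (x ∷ xs)                                 ∎
    where open ≡-Reasoning

  sum-filter-vanishing : ∀ {ℓ} {P : A → Set ℓ} (P? : ∀ x → Dec (P x)) (f : A → ℕ) xs →
    (∀ x → ¬ P x → f x ≡ 0) → sum (map f (filter P? xs)) ≡ sum (map f xs)
  sum-filter-vanishing P? f [] h = refl
  sum-filter-vanishing P? f (x ∷ xs) h with P? x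
  ... | yes _ = cong (f x +_) (sum-filter-vanishing P? f xs h)
  ... | no ¬Px = trans (sum-filter-vanishing P? f xs h) (cong (_+ sum (map f xs)) (sym (h x ¬Px)))

  sumWhere-split : ∀ f p r xs → sumWhere f p xs ≡ sumWhere f (p ∩ r) xs + sumWhere f (p ∩ ∁ r) xs
  sumWhere-split f p r [] = refl
  sumWhere-split f p r (x ∷ xs) = begin
    sumWhere f p (x ∷ xs)
      ≡⟨ sumWhere-∷ f p x xs ⟩
    at (p x) + sumWhere f p xs
      ≡⟨ cong₂ _+_ (pointwise (p x) (r x)) (sumWhere-split f p r xs) ⟩
    (at (p x ∧ r x) + at (p x ∧ not (r x))) + (sumWhere f (p ∩ r) xs + sumWhere f (p ∩ ∁ r) xs)
      ≡⟨ interchange (at (p x ∧ r x)) _ _ _ ⟩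
    (at (p x ∧ r x) + sumWhere f (p ∩ r) xs) + (at (p x ∧ not (r x)) + sumWhere f (p ∩ ∁ r) xs)
      ≡⟨ cong₂ _+_ (sumWhere-∷ f (p ∩ r) x xs) (sumWhere-∷ f (p ∩ ∁ r) x xs) ⟨
    sumWhere f (p ∩ r) (x ∷ xs) + sumWhere f (p ∩ ∁ r) (x ∷ xs) ∎
    where
    open ≡-Reasoning
    at : Bool → ℕ
    at b = if b then f x else 0
    interchange : ∀ a b c d → (a + b) + (c + d) ≡ (a + c) + (b + d)
    interchange = solve-∀
    pointwise : ∀ a b → at a ≡ at (a ∧ b) + at (a ∧ not b)
    pointwise true  true  = sym (ℕ.+-identityʳ _)
    pointwise true  false = refl
    pointwise false true  = refl
    pointwise false false = refl

  sumWhere-const : ∀ f p c xs → (∀ x → p x ≡ true → f x ≡ c) → sumWhere f p xs ≡ c * count p xs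
  sumWhere-const f p c [] h = sym (ℕ.*-zeroʳ c)
  sumWhere-const f p c (x ∷ xs) h = begin
    sumWhere f p (x ∷ xs)                          ≡⟨ sumWhere-∷ f p x xs ⟩
    (if p x then f x else 0) + sumWhere f p xs     ≡⟨ cong₂ _+_ (pointwise (p x) (h x)) (sumWhere-const f p c xs h) ⟩
    c * toℕ (p x) + c * count p xs                 ≡⟨ ℕ.*-distribˡ-+ c (toℕ (p x)) _ ⟨
    c * (toℕ (p x) + count p xs)                   ≡⟨ cong (c *_) (count-∷ p x xs) ⟨
    c * count p (x ∷ xs)                           ∎
    where
    open ≡-Reasoning
    pointwise : ∀ a → (a ≡ true → f x ≡ c) → (if a then f x else 0) ≡ c * toℕ a
    pointwise true g = trans (g refl) (sym (ℕ.*-identityʳ c))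
    pointwise false g = sym (ℕ.*-zeroʳ c)

  sumWhere-cong : ∀ f g p xs → (∀ x → p x ≡ true → f x ≡ g x) → sumWhere f p xs ≡ sumWhere g p xs
  sumWhere-cong f g p [] e = refl
  sumWhere-cong f g p (x ∷ xs) e =
    trans (sumWhere-∷ f p x xs) (trans (cong₂ _+_ (pointwise (p x) (e x)) (sumWhere-cong f g p xs e)) (sym (sumWhere-∷ g p x xs)))
    where
    pointwise : ∀ a → (a ≡ true → f x ≡ g x) → (if a then f x else 0) ≡ (if a then g x else 0)
    pointwise true h = h refl
    pointwise false h = refl

module _ {A B : Set} where

  count-map : ∀ p (f : B → A) xs → count p (map f xs) ≡ count (λ x → p (f x)) xs
  count-map p f [] = refl
  count-map p f (x ∷ xs) =
    trans (count-∷ p (f x) (map f xs)) (trans (cong (toℕ (p (f x)) +_) (count-map p f xs)) (sym (count-∷ (λ x → p (f x)) x xs)))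

  count-concatMap : ∀ p (f : B → List A) xs → count p (concatMap f xs) ≡ sum (map (λ x → count p (f x)) xs)
  count-concatMap p f [] = refl
  count-concatMap p f (x ∷ xs) = trans (count-++ p (f x) (concatMap f xs)) (cong (count p (f x) +_) (count-concatMap p f xs))

-- Finite enumerations

record Enumeration (A : Set) : Set where
  field
    _≟_ : DecidableEquality A
    elements : List A
    complete : ∀ x → x ∈ elements
    unique : Unique elements

module EnumerationProperties {A : Set} (E : Enumeration A) where
  open Enumeration E

  is : A → A → Bool
  is a x = ⌊ x ≟ a ⌋

  memberOf : List A → A → Bool
  memberOf ys x = any (λ y → ⌊ x ≟ y ⌋) ys

  is-refl : ∀ a → is a a ≡ true
  is-refl a with a ≟ a
  ... | yes _ = refl
  ... | no a≢a = ⊥-elim (a≢a refl)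

  is⇒≡ : ∀ a x → is a x ≡ true → x ≡ a
  is⇒≡ a x h with x ≟ a
  ... | yes x≡a = x≡a

  ≢⇒is-false : ∀ a x → x ≢ a → is a x ≡ false
  ≢⇒is-false a x x≢a with x ≟ a
  ... | yes x≡a = ⊥-elim (x≢a x≡a)
  ... | no _ = refl

  count-is-absent : ∀ a ys → All (a ≢_) ys → count (is a) ys ≡ 0
  count-is-absent a [] [] = refl
  count-is-absent a (y ∷ ys) (a≢y ∷ a∉ys) =
    trans (count-∷ (is a) y ys) (cong₂ (λ b n → toℕ b + n) (≢⇒is-false a y (λ y≡a → a≢y (sym y≡a))) (count-is-absent a ys a∉ys))

  count-is-unique : ∀ a xs → Unique xs → a ∈ xs → count (is a) xs ≡ 1
  count-is-unique a (x ∷ xs) (a∉xs ∷ _) (here refl) =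
    trans (count-∷ (is a) a xs) (cong₂ (λ b n → toℕ b + n) (is-refl a) (count-is-absent a xs a∉xs))
  count-is-unique a (x ∷ xs) (x∉xs ∷ u) (there a∈xs) =
    trans (count-∷ (is a) x xs) (cong₂ (λ b n → toℕ b + n) (≢⇒is-false a x x≢a) (count-is-unique a xs u a∈xs))
    where
    x≢a : x ≢ a
    x≢a refl = All.lookup x∉xs a∈xs refl

  count-is : ∀ a → count (is a) elements ≡ 1
  count-is a = count-is-unique a elements unique (complete a)

  count-pos : ∀ p x → p x ≡ true → 1 ≤ count p elements
  count-pos p x px = subst (_≤ count p elements) (count-is x)
    (count-mono (is x) p elements (λ y e → subst (λ z → p z ≡ true) (sym (is⇒≡ x y e)) px))

  count≡0⇒false : ∀ p x → count p elements ≡ 0 → p x ≡ false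
  count≡0⇒false p x h = false-if-not-true (λ px → ℕ.<-irrefl (sym h) (count-pos p x px))

  count-singleton : ∀ p a → p a ≡ true → (∀ x → p x ≡ true → x ≡ a) → count p elements ≡ 1
  count-singleton p a pa only-a = trans (count-cong p (is a) elements p≗is-a) (count-is a)
    where
    p≗is-a : ∀ x → p x ≡ is a x
    p≗is-a x with x ≟ a
    ... | yes refl = pa
    ... | no x≢a = false-if-not-true (λ px → x≢a (only-a x px))

  count-remove : ∀ p a → p a ≡ true → count p elements ≡ suc (count (p ∩ ∁ (is a)) elements)
  count-remove p a pa = trans (count-split p (is a) elements)
    (cong (_+ count (p ∩ ∁ (is a)) elements) (count-singleton (p ∩ is a) a (∧-intro pa (is-refl a)) (λ x e → is⇒≡ a x (proj₂ (∧-true e)))))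

  count≡1⇒unique : ∀ p a b → count p elements ≡ 1 → p a ≡ true → p b ≡ true → a ≡ b
  count≡1⇒unique p a b h pa pb with b ≟ a
  ... | yes b≡a = sym b≡a
  ... | no b≢a = ⊥-elim (true≢false (∧-intro pb (cong not (≢⇒is-false a b b≢a)))
                          (count≡0⇒false (p ∩ ∁ (is a)) b (ℕ.suc-injective (trans (sym (count-remove p a pa)) h))))

  count-memberOf : ∀ ys → Unique ys → count (memberOf ys) elements ≡ length ys
  count-memberOf [] _ = count-none _ elements (λ _ → refl)
  count-memberOf (y ∷ ys) (y∉ys ∷ u) = begin
    count (is y ∪ memberOf ys) elements
      ≡⟨ ℕ.+-identityʳ _ ⟨
    count (is y ∪ memberOf ys) elements + 0
      ≡⟨ cong (count (is y ∪ memberOf ys) elements +_) (count-none _ elements disjoint) ⟨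
    count (is y ∪ memberOf ys) elements + count (is y ∩ memberOf ys) elements
      ≡⟨ count-∪+count-∩ (is y) (memberOf ys) elements ⟩
    count (is y) elements + count (memberOf ys) elements
      ≡⟨ cong₂ _+_ (count-is y) (count-memberOf ys u) ⟩
    suc (length ys) ∎
    where
    open ≡-Reasoning
    memberOf-absent : ∀ x zs → All (x ≢_) zs → memberOf zs x ≡ false
    memberOf-absent x [] [] = refl
    memberOf-absent x (z ∷ zs) (x≢z ∷ x∉zs) with x ≟ z
    ... | yes x≡z = ⊥-elim (x≢z x≡z)
    ... | no _ = memberOf-absent x zs x∉zs
    disjoint : ∀ x → (is y ∩ memberOf ys) x ≡ false
    disjoint x with x ≟ y
    ... | yes refl = memberOf-absent x ys y∉ys
    ... | no _ = refl

  sumWhere-remove : ∀ f p a → p a ≡ true → sumWhere f p elements ≡ f a + sumWhere f (p ∩ ∁ (is a)) elements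
  sumWhere-remove f p a pa = trans (sumWhere-split f p (is a) elements) (cong (_+ sumWhere f (p ∩ ∁ (is a)) elements) (begin
    sumWhere f (p ∩ is a) elements   ≡⟨ sumWhere-const f (p ∩ is a) (f a) elements (λ x e → cong f (at-a x e)) ⟩
    f a * count (p ∩ is a) elements  ≡⟨ cong (f a *_) (count-singleton (p ∩ is a) a (∧-intro pa (is-refl a)) at-a) ⟩
    f a * 1                          ≡⟨ ℕ.*-identityʳ (f a) ⟩
    f a                              ∎))
    where
    open ≡-Reasoning
    at-a : ∀ x → (p ∩ is a) x ≡ true → x ≡ a
    at-a x e = is⇒≡ a x (proj₂ (∧-true e))

  sumWhere-const-except : ∀ f p c ms → Unique ms → All (λ m → p m ≡ true) ms →
    (∀ x → p x ≡ true → x ∉ ms → f x ≡ c) →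
    sumWhere f p elements ≡ sum (map f ms) + c * (count p elements ∸ length ms)
  sumWhere-const-except f p c [] _ _ const = sumWhere-const f p c elements (λ x px → const x px λ ())
  sumWhere-const-except f p c (m ∷ ms) (m∉ms ∷ u) (pm ∷ p-ms) const = begin
    sumWhere f p elements
      ≡⟨ sumWhere-remove f p m pm ⟩
    f m + sumWhere f p′ elements
      ≡⟨ cong (f m +_) (sumWhere-const-except f p′ c ms u (All.tabulate p′-ms) const′) ⟩
    f m + (sum (map f ms) + c * (count p′ elements ∸ length ms))
      ≡⟨ ℕ.+-assoc (f m) _ _ ⟨
    f m + sum (map f ms) + c * (count p′ elements ∸ length ms)
      ≡⟨ cong (λ n → f m + sum (map f ms) + c * (n ∸ suc (length ms))) (count-remove p m pm) ⟨
    f m + sum (map f ms) + c * (count p elements ∸ suc (length ms)) ∎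
    where
    open ≡-Reasoning
    p′ : A → Bool
    p′ = p ∩ ∁ (is m)
    p′-ms : ∀ {x} → x ∈ ms → p′ x ≡ true
    p′-ms {x} x∈ms = ∧-intro (All.lookup p-ms x∈ms) (cong not (≢⇒is-false m x (λ x≡m → All.lookup m∉ms x∈ms (sym x≡m))))
    const′ : ∀ x → p′ x ≡ true → x ∉ ms → f x ≡ c
    const′ x e x∉ms = const x (proj₁ (∧-true e)) λ
      { (here x≡m) → true≢false (is-refl m) (subst (λ z → is m z ≡ false) x≡m (not-true (proj₂ (∧-true e))))
      ; (there x∈ms) → x∉ms x∈ms }

  memberOf⇒∈ : ∀ x ys → memberOf ys x ≡ true → x ∈ ys
  memberOf⇒∈ x (y ∷ ys) h with x ≟ y
  ... | yes x≡y = here x≡y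
  ... | no _ = there (memberOf⇒∈ x ys h)

  ∈⇒memberOf : ∀ x ys → x ∈ ys → memberOf ys x ≡ true
  ∈⇒memberOf x (y ∷ ys) x∈ys with x ≟ y | x∈ys
  ... | yes _ | _ = refl
  ... | no x≢y | here x≡y = ⊥-elim (x≢y x≡y)
  ... | no _ | there x∈ys′ = ∈⇒memberOf x ys x∈ys′

-- Finite projective planes and the four saturating sets

record ProjectivePlane : Set₁ where
  field
    Point Line : Set
    pointEnumeration : Enumeration Point
    lineEnumeration : Enumeration Line
    incident? : Point → Line → Bool
    Incident : Point → Line → Set
    Incident⇒incident? : ∀ {P ℓ} → Incident P ℓ → incident? P ℓ ≡ true
    incident?⇒Incident : ∀ {P ℓ} → incident? P ℓ ≡ true → Incident P ℓ
    q : ℕ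

  points : List Point
  points = Enumeration.elements pointEnumeration

  lines : List Line
  lines = Enumeration.elements lineEnumeration

  on : Line → Point → Bool
  on ℓ P = incident? P ℓ

  field
    2≤q : 2 ≤ q
    points-count : length points ≡ suc (q + q * q)
    line-size : ∀ ℓ → count (on ℓ) points ≡ suc q
    pencil-size : ∀ P → count (incident? P) lines ≡ suc q
    lines-meet-once : ∀ ℓ ℓ′ → ℓ ≢ ℓ′ → count (on ℓ ∩ on ℓ′) points ≡ 1
    points-join-once : ∀ P P′ → P ≢ P′ → count (incident? P ∩ incident? P′) lines ≡ 1

module PlaneGeometry (Π : ProjectivePlane) where
  open ProjectivePlane Π public
  open Enumeration pointEnumeration using () renaming (_≟_ to _≟P_)
  open Enumeration lineEnumeration using () renaming (_≟_ to _≟L_)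
  module Points = EnumerationProperties pointEnumeration
  module Lines = EnumerationProperties lineEnumeration

  -- The notions of Defs.PG, for an arbitrary projective plane; for PG(2,K) they
  -- unfold to exactly the Defs.PG ones.

  PointSet : Set
  PointSet = Point → Bool

  size : PointSet → ℕ
  size S = count S points

  meet : PointSet → Line → ℕ
  meet S ℓ = count (S ∩ on ℓ) points

  multiplicity : PointSet → Line → ℕ
  multiplicity S ℓ = meet S ℓ C 2

  secantSum : PointSet → Point → ℕ
  secantSum S Q =
    sum (map (multiplicity S) (filter (λ ℓ → 2 ℕ.≤? meet S ℓ) (filter (λ ℓ → incident? Q ℓ Bool.≟ true) lines)))

  Spans : PointSet → Set
  Spans S = ¬ Σ Line (λ ℓ → ∀ P → S P ≡ true → Incident P ℓ)

  IsSaturating : PointSet → ℕ → Set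
  IsSaturating S μ = Spans S × (¬ (∀ P → S P ≡ true)) × (∀ Q → S Q ≡ false → μ ≤ secantSum S Q)

  IsOptimalSaturating : PointSet → ℕ → Set
  IsOptimalSaturating S μ = IsSaturating S μ × (∀ Q → S Q ≡ false → secantSum S Q ≡ μ)

  unionOfLines : List Line → PointSet
  unionOfLines ls P = any (incident? P) ls

  inList : List Point → Point → Bool
  inList = Points.memberOf

  NonConcurrent : Line → Line → Line → Set
  NonConcurrent ℓ₁ ℓ₂ ℓ₃ = ¬ Σ Point (λ P → Incident P ℓ₁ × Incident P ℓ₂ × Incident P ℓ₃)

  triangle : Line → Line → Line → PointSet
  triangle ℓ₁ ℓ₂ ℓ₃ P = anyOf₃ (incident? P ℓ₁) (incident? P ℓ₂) (incident? P ℓ₃)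

  vertexlessTriangle : Line → Line → Line → PointSet
  vertexlessTriangle ℓ₁ ℓ₂ ℓ₃ P = exactlyOne (incident? P ℓ₁) (incident? P ℓ₂) (incident? P ℓ₃)

  infix 4 _∈ₗ_ _∉ₗ_

  _∈ₗ_ _∉ₗ_ : Point → Line → Set
  P ∈ₗ ℓ = incident? P ℓ ≡ true
  P ∉ₗ ℓ = incident? P ℓ ≡ false

  distinct-lines : ∀ {P ℓ ℓ′} → P ∈ₗ ℓ → P ∉ₗ ℓ′ → ℓ ≢ ℓ′
  distinct-lines Pℓ Pℓ′ refl = true≢false Pℓ Pℓ′

  distinct-points : ∀ {P P′ ℓ} → P ∈ₗ ℓ → P′ ∉ₗ ℓ → P ≢ P′
  distinct-points Pℓ P′ℓ refl = true≢false Pℓ P′ℓ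

  meet-unique : ∀ {ℓ ℓ′ P P′} → ℓ ≢ ℓ′ → P ∈ₗ ℓ → P ∈ₗ ℓ′ → P′ ∈ₗ ℓ → P′ ∈ₗ ℓ′ → P ≡ P′
  meet-unique {ℓ} {ℓ′} {P} {P′} ℓ≢ℓ′ Pℓ Pℓ′ P′ℓ P′ℓ′ =
    Points.count≡1⇒unique (on ℓ ∩ on ℓ′) P P′ (lines-meet-once ℓ ℓ′ ℓ≢ℓ′) (∧-intro Pℓ Pℓ′) (∧-intro P′ℓ P′ℓ′)

  join-unique : ∀ {P P′ ℓ ℓ′} → P ≢ P′ → P ∈ₗ ℓ → P′ ∈ₗ ℓ → P ∈ₗ ℓ′ → P′ ∈ₗ ℓ′ → ℓ ≡ ℓ′
  join-unique {P} {P′} {ℓ} {ℓ′} P≢P′ Pℓ P′ℓ Pℓ′ P′ℓ′ =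
    Lines.count≡1⇒unique (incident? P ∩ incident? P′) ℓ ℓ′ (points-join-once P P′ P≢P′)
      (∧-intro Pℓ P′ℓ) (∧-intro Pℓ′ P′ℓ′)

  intersection : ∀ ℓ ℓ′ → ℓ ≢ ℓ′ → Σ Point (λ P → P ∈ₗ ℓ × P ∈ₗ ℓ′)
  intersection ℓ ℓ′ ℓ≢ℓ′ with count-witness (on ℓ ∩ on ℓ′) points (ℕ.≤-reflexive (sym (lines-meet-once ℓ ℓ′ ℓ≢ℓ′)))
  ... | P , e = P , ∧-true e

  join : ∀ P P′ → P ≢ P′ → Σ Line (λ ℓ → P ∈ₗ ℓ × P′ ∈ₗ ℓ)
  join P P′ P≢P′ with count-witness (incident? P ∩ incident? P′) lines (ℕ.≤-reflexive (sym (points-join-once P P′ P≢P′)))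
  ... | ℓ , e = ℓ , ∧-true e

  point-on : ∀ ℓ → Σ Point (_∈ₗ ℓ)
  point-on ℓ = count-witness (on ℓ) points (subst (1 ≤_) (sym (line-size ℓ)) (s≤s z≤n))

  point-off : ∀ ℓ ℓ′ → ℓ ≢ ℓ′ → Σ Point (λ P → P ∈ₗ ℓ × P ∉ₗ ℓ′)
  point-off ℓ ℓ′ ℓ≢ℓ′ with count-witness (on ℓ ∩ ∁ (on ℓ′)) points at-least-one
    where
    at-least-one : 1 ≤ count (on ℓ ∩ ∁ (on ℓ′)) points
    at-least-one = subst (1 ≤_) (ℕ.suc-injective (begin
      suc q                                              ≡⟨ line-size ℓ ⟨
      count (on ℓ) points                                ≡⟨ count-split (on ℓ) (on ℓ′) points ⟩
      count (on ℓ ∩ on ℓ′) points + count (on ℓ ∩ ∁ (on ℓ′)) points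
                                                         ≡⟨ cong (_+ count (on ℓ ∩ ∁ (on ℓ′)) points) (lines-meet-once ℓ ℓ′ ℓ≢ℓ′) ⟩
      suc (count (on ℓ ∩ ∁ (on ℓ′)) points)              ∎)) (ℕ.≤-trans (s≤s z≤n) 2≤q)
      where open ≡-Reasoning
  ... | P , e = P , proj₁ (∧-true e) , not-true (proj₂ (∧-true e))

  points-off-line : ∀ ℓ → count (∁ (on ℓ)) points ≡ q * q
  points-off-line ℓ = ℕ.+-cancelˡ-≡ (suc q) _ _
    (trans (cong (_+ count (∁ (on ℓ)) points) (sym (line-size ℓ))) (trans (count+count-∁ (on ℓ) points) points-count))

  meet+outside : ∀ S ℓ → meet S ℓ + count (on ℓ ∩ ∁ S) points ≡ suc q
  meet+outside S ℓ = begin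
    meet S ℓ + count (on ℓ ∩ ∁ S) points
      ≡⟨ cong (_+ count (on ℓ ∩ ∁ S) points) (count-cong (S ∩ on ℓ) (on ℓ ∩ S) points (λ P → Bool.∧-comm (S P) (incident? P ℓ))) ⟩
    count (on ℓ ∩ S) points + count (on ℓ ∩ ∁ S) points
      ≡⟨ count-split (on ℓ) S points ⟨
    count (on ℓ) points
      ≡⟨ line-size ℓ ⟩
    suc q ∎
    where open ≡-Reasoning

  secantSum≡sumWhere : ∀ S Q → secantSum S Q ≡ sumWhere (multiplicity S) (incident? Q) lines
  secantSum≡sumWhere S Q =
    sum-filter-vanishing (λ ℓ → 2 ℕ.≤? meet S ℓ) (multiplicity S) (filter (λ ℓ → incident? Q ℓ Bool.≟ true) lines)
      (λ ℓ → [n<2]C2≡0 (meet S ℓ))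
    where
    [n<2]C2≡0 : ∀ n → ¬ 2 ≤ n → n C 2 ≡ 0
    [n<2]C2≡0 0 _ = refl
    [n<2]C2≡0 1 _ = refl
    [n<2]C2≡0 (suc (suc n)) 2≰n = ⊥-elim (2≰n (s≤s (s≤s z≤n)))

  secantSum-cong : ∀ S S′ Q → (∀ P → S P ≡ S′ P) → secantSum S Q ≡ secantSum S′ Q
  secantSum-cong S S′ Q S≗S′ = begin
    secantSum S Q                                    ≡⟨ secantSum≡sumWhere S Q ⟩
    sumWhere (multiplicity S) (incident? Q) lines    ≡⟨ sumWhere-cong _ _ _ lines (λ ℓ _ → cong (_C 2) (meet-cong ℓ)) ⟩
    sumWhere (multiplicity S′) (incident? Q) lines   ≡⟨ secantSum≡sumWhere S′ Q ⟨
    secantSum S′ Q                                   ∎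
    where
    open ≡-Reasoning
    meet-cong : ∀ ℓ → meet S ℓ ≡ meet S′ ℓ
    meet-cong ℓ = count-cong (S ∩ on ℓ) (S′ ∩ on ℓ) points (λ P → cong (_∧ incident? P ℓ) (S≗S′ P))

  secantSum-const-except : ∀ S Q c ms → Unique ms → All (Q ∈ₗ_) ms →
    (∀ ℓ → Q ∈ₗ ℓ → ℓ ∉ ms → multiplicity S ℓ ≡ c) →
    secantSum S Q ≡ sum (map (multiplicity S) ms) + c * (suc q ∸ length ms)
  secantSum-const-except S Q c ms u Q∈ms const = begin
    secantSum S Q
      ≡⟨ secantSum≡sumWhere S Q ⟩
    sumWhere (multiplicity S) (incident? Q) lines
      ≡⟨ Lines.sumWhere-const-except (multiplicity S) (incident? Q) c ms u Q∈ms const ⟩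
    sum (map (multiplicity S) ms) + c * (count (incident? Q) lines ∸ length ms)
      ≡⟨ cong (λ n → sum (map (multiplicity S) ms) + c * (n ∸ length ms)) (pencil-size Q) ⟩
    sum (map (multiplicity S) ms) + c * (suc q ∸ length ms) ∎
    where open ≡-Reasoning

  spans-two-lines : ∀ S ℓ₁ ℓ₂ → ℓ₁ ≢ ℓ₂ →
    (∀ P → P ∈ₗ ℓ₁ → S P ≡ true) → (∀ P → P ∈ₗ ℓ₂ → S P ≡ true) → Spans S
  spans-two-lines S ℓ₁ ℓ₂ ℓ₁≢ℓ₂ ℓ₁⊆S ℓ₂⊆S (ℓ , S⊆ℓ) with ℓ ≟L ℓ₁
  ... | yes refl = let (P , Pℓ₂ , Pℓ) = point-off ℓ₂ ℓ (λ ℓ₂≡ℓ → ℓ₁≢ℓ₂ (sym ℓ₂≡ℓ)) in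
                   true≢false (Incident⇒incident? (S⊆ℓ P (ℓ₂⊆S P Pℓ₂))) Pℓ
  ... | no ℓ≢ℓ₁ = let (P , Pℓ₁ , Pℓ) = point-off ℓ₁ ℓ (λ ℓ₁≡ℓ → ℓ≢ℓ₁ (sym ℓ₁≡ℓ)) in
                  true≢false (Incident⇒incident? (S⊆ℓ P (ℓ₁⊆S P Pℓ₁))) Pℓ

  join-avoids : ∀ {Q V W s m} → V ≢ W → V ∈ₗ s → W ∈ₗ s → Q ∉ₗ s → Q ∈ₗ m → V ∈ₗ m → W ∉ₗ m
  join-avoids V≢W Vs Ws Qs Qm Vm = false-if-not-true λ Wm →
    true≢false (subst (_ ∈ₗ_) (join-unique V≢W Vm Wm Vs Ws) Qm) Qs

  off-other-line : ∀ {Q V ℓ m} → Q ≢ V → Q ∈ₗ m → V ∈ₗ m → Q ∈ₗ ℓ → ℓ ≢ m → V ∉ₗ ℓ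
  off-other-line Q≢V Qm Vm Qℓ ℓ≢m = false-if-not-true λ Vℓ → ℓ≢m (join-unique Q≢V Qℓ Vℓ Qm Vm)

  count-at-point : ∀ d {a b V} → a ≢ b → V ∈ₗ a → V ∈ₗ b → count (d ∩ on a ∩ on b) points ≡ toℕ (d V)
  count-at-point d {a} {b} {V} a≢b Va Vb with d V in dV
  ... | true = Points.count-singleton (d ∩ on a ∩ on b) V (∧-intro dV (∧-intro Va Vb))
                 λ P e → let (Pa , Pb) = ∧-true (proj₂ (∧-true {d P} e)) in meet-unique a≢b Pa Pb Va Vb
  ... | false = count-none (d ∩ on a ∩ on b) points λ P → false-if-not-true λ e →
                  let (dP , Pab) = ∧-true {d P} e
                      (Pa , Pb) = ∧-true Pab
                  in true≢false (subst (λ X → d X ≡ true) (meet-unique a≢b Pa Pb Va Vb) dP) dV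

  spans-union : ∀ S ls → Unique ls → 2 ≤ length ls → (∀ P ℓ → ℓ ∈ ls → P ∈ₗ ℓ → S P ≡ true) → Spans S
  spans-union S (_ ∷ []) _ (s≤s ()) _
  spans-union S (ℓ₁ ∷ ℓ₂ ∷ _) ((ℓ₁≢ℓ₂ ∷ _) ∷ _) _ ls⊆S =
    spans-two-lines S ℓ₁ ℓ₂ ℓ₁≢ℓ₂ (λ P → ls⊆S P ℓ₁ (here refl)) (λ P → ls⊆S P ℓ₂ (there (here refl)))

  not-everything : ∀ S → size S < length points → ¬ (∀ P → S P ≡ true)
  not-everything S size<total S-all = ℕ.<-irrefl (count-all S points S-all) size<total

  optimal : ∀ S μ → Spans S → size S < length points → (∀ Q → S Q ≡ false → secantSum S Q ≡ μ) → IsOptimalSaturating S μ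
  optimal S μ spans small exact = (spans , not-everything S small , λ Q Q∉S → ℕ.≤-reflexive (sym (exact Q Q∉S))) , exact

  union-contains : ∀ {P ℓ} ls → ℓ ∈ ls → P ∈ₗ ℓ → unionOfLines ls P ≡ true
  union-contains {P} (ℓ ∷ ls) (here refl) Pℓ rewrite Pℓ = refl
  union-contains {P} (ℓ′ ∷ ls) (there ℓ∈ls) Pℓ rewrite union-contains ls ℓ∈ls Pℓ = Bool.∨-zeroʳ (incident? P ℓ′)

  union-witness : ∀ {P} ls → unionOfLines ls P ≡ true → Σ Line (λ ℓ → ℓ ∈ ls × P ∈ₗ ℓ)
  union-witness {P} (ℓ ∷ ls) h with incident? P ℓ in Pℓ
  ... | true = ℓ , here refl , Pℓ
  ... | false = let (ℓ′ , ℓ′∈ls , Pℓ′) = union-witness ls h in ℓ′ , there ℓ′∈ls , Pℓ′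

  -- Lines through G meet any line ℓ ∌ G in distinct points, so the union sees |ls| points on ℓ.
  pencil-union-meet : ∀ G ℓ ls → Unique ls → All (Incident G) ls → G ∉ₗ ℓ → meet (unionOfLines ls) ℓ ≡ length ls
  pencil-union-meet G ℓ [] _ _ _ = count-none _ points (λ _ → refl)
  pencil-union-meet G ℓ (l ∷ ls) (l∉ls ∷ u) (Gl ∷ Gls) Gℓ = begin
    meet (on l ∪ U) ℓ
      ≡⟨ count-cong _ _ points (λ P → Bool.∧-distribʳ-∨ (incident? P ℓ) (incident? P l) (U P)) ⟩
    count (on l ∩ on ℓ ∪ U ∩ on ℓ) points
      ≡⟨ ℕ.+-identityʳ _ ⟨
    count (on l ∩ on ℓ ∪ U ∩ on ℓ) points + 0
      ≡⟨ cong (count (on l ∩ on ℓ ∪ U ∩ on ℓ) points +_) (count-none _ points disjoint) ⟨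
    count (on l ∩ on ℓ ∪ U ∩ on ℓ) points + count ((on l ∩ on ℓ) ∩ (U ∩ on ℓ)) points
      ≡⟨ count-∪+count-∩ (on l ∩ on ℓ) (U ∩ on ℓ) points ⟩
    count (on l ∩ on ℓ) points + meet U ℓ
      ≡⟨ cong₂ _+_ (lines-meet-once l ℓ l≢ℓ) (pencil-union-meet G ℓ ls u Gls Gℓ) ⟩
    suc (length ls) ∎
    where
    open ≡-Reasoning
    U = unionOfLines ls
    l≢ℓ : l ≢ ℓ
    l≢ℓ refl = true≢false (Incident⇒incident? Gl) Gℓ
    disjoint : ∀ P → ((on l ∩ on ℓ) ∩ (U ∩ on ℓ)) P ≡ false
    disjoint P = false-if-not-true λ e →
      let (Pl , Pℓ) = ∧-true (proj₁ (∧-true e))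
          P∈U = proj₁ (∧-true {U P} (proj₂ (∧-true {incident? P l ∧ incident? P ℓ} e)))
          (l′ , l′∈ls , Pl′) = union-witness ls P∈U
      in true≢false (subst (_∈ₗ ℓ) (meet-unique (All.lookup l∉ls l′∈ls) Pl Pl′
                       (Incident⇒incident? Gl) (Incident⇒incident? (All.lookup Gls l′∈ls))) Pℓ) Gℓ

  pencil-union-size : ∀ G ℓ ls → Unique (ℓ ∷ ls) → All (Incident G) (ℓ ∷ ls) →
    size (unionOfLines (ℓ ∷ ls)) ≡ 1 + length (ℓ ∷ ls) * q
  pencil-union-size G ℓ [] _ _ = begin
    count (λ P → incident? P ℓ ∨ false) points   ≡⟨ count-cong _ (on ℓ) points (λ P → Bool.∨-identityʳ (incident? P ℓ)) ⟩
    count (on ℓ) points                          ≡⟨ line-size ℓ ⟩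
    suc q                                        ≡⟨ cong suc (ℕ.*-identityˡ q) ⟨
    1 + 1 * q                                    ∎
    where open ≡-Reasoning
  pencil-union-size G ℓ (ℓ′ ∷ ls) (ℓ∉ℓ′ls ∷ u) (Gℓ ∷ Gℓ′ls) = ℕ.+-cancelʳ-≡ 1 _ _ (begin
    size (on ℓ ∪ U) + 1
      ≡⟨ cong (size (on ℓ ∪ U) +_) only-G ⟨
    size (on ℓ ∪ U) + count (on ℓ ∩ U) points
      ≡⟨ count-∪+count-∩ (on ℓ) U points ⟩
    count (on ℓ) points + size U
      ≡⟨ cong₂ _+_ (line-size ℓ) (pencil-union-size G ℓ′ ls u Gℓ′ls) ⟩
    suc q + (1 + suc (length ls) * q)
      ≡⟨ arithmetic q (length ls) ⟩
    1 + suc (suc (length ls)) * q + 1 ∎)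
    where
    open ≡-Reasoning
    U = unionOfLines (ℓ′ ∷ ls)
    arithmetic : ∀ q n → suc q + (1 + suc n * q) ≡ 1 + suc (suc n) * q + 1
    arithmetic = solve-∀
    G∈ℓ = Incident⇒incident? Gℓ
    only-G : count (on ℓ ∩ U) points ≡ 1
    only-G = Points.count-singleton (on ℓ ∩ U) G
      (∧-intro G∈ℓ (union-contains (ℓ′ ∷ ls) (here refl) (Incident⇒incident? (All.head Gℓ′ls))))
      λ P e → let (Pℓ , P∈U) = ∧-true e
                  (l , l∈U , Pl) = union-witness (ℓ′ ∷ ls) P∈U
              in meet-unique (All.lookup ℓ∉ℓ′ls l∈U) Pℓ Pl G∈ℓ (Incident⇒incident? (All.lookup Gℓ′ls l∈U))

  concurrent-lines-optimal : (L : ℕ) → 2 ≤ L → L ≤ q → (G : Point) (ls : List Line) →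
    length ls ≡ L → Unique ls → All (Incident G) ls →
    (size (unionOfLines ls) ≡ 1 + L * q) × IsOptimalSaturating (unionOfLines ls) ((L C 2) * q)
  concurrent-lines-optimal _ () _ G [] refl _ _
  concurrent-lines-optimal _ (s≤s ()) _ G (_ ∷ []) refl _ _
  concurrent-lines-optimal L 2≤L L≤q G ls@(ℓ₁ ∷ ℓ₂ ∷ _) refl u Gls =
    size-S , optimal S μ spans (subst₂ _<_ (sym size-S) (sym points-count) small) secant
    where
    S = unionOfLines ls
    μ = (L C 2) * q
    size-S : size S ≡ 1 + L * q
    size-S = pencil-union-size G ℓ₁ (ℓ₂ ∷ _) u Gls
    spans : Spans S
    spans = spans-union S ls u (s≤s (s≤s z≤n)) (λ P ℓ → union-contains ls)
    small : 1 + L * q < suc (q + q * q)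
    small = s≤s (ℕ.+-mono-≤ (ℕ.≤-trans (s≤s z≤n) 2≤q) (ℕ.*-monoˡ-≤ q L≤q))
    G∈S : S G ≡ true
    G∈S = union-contains ls (here refl) (Incident⇒incident? (All.head Gls))
    secant : ∀ Q → S Q ≡ false → secantSum S Q ≡ μ
    secant Q Q∉S = trans (secantSum-const-except S Q (L C 2) (m ∷ []) ([] ∷ []) (Qm ∷ []) others)
                         (cong (λ n → n C 2 + 0 + μ) meet-m)
      where
      Q≢G : Q ≢ G
      Q≢G refl = true≢false G∈S Q∉S
      m = proj₁ (join Q G Q≢G)
      Qm = proj₁ (proj₂ (join Q G Q≢G))
      Gm = proj₂ (proj₂ (join Q G Q≢G))
      meet-m : meet S m ≡ 1
      meet-m = Points.count-singleton (S ∩ on m) G (∧-intro G∈S Gm) λ P e →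
        let (P∈S , Pm) = ∧-true e
            (l , l∈ls , Pl) = union-witness ls P∈S
            l≢m : l ≢ m
            l≢m l≡m = true≢false (union-contains ls l∈ls (subst (Q ∈ₗ_) (sym l≡m) Qm)) Q∉S
        in meet-unique l≢m Pl Pm (Incident⇒incident? (All.lookup Gls l∈ls)) Gm
      others : ∀ ℓ → Q ∈ₗ ℓ → ℓ ∉ m ∷ [] → multiplicity S ℓ ≡ L C 2
      others ℓ Qℓ ℓ∉m = cong (_C 2) (pencil-union-meet G ℓ ls u Gls
        (false-if-not-true λ Gℓ → ℓ∉m (here (join-unique Q≢G Qℓ Gℓ Qm Gm))))

  module PencilWithPoints (G : Point) (ls : List Line) (m : Line) (B : List Point)
    (ls-size : length ls ≡ q) (ls-unique : Unique ls) (G∈ls : All (Incident G) ls)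
    (G∈m : Incident G m) (m∉ls : m ∉ ls) (B-unique : Unique B) (B⊆m∖G : All (λ P → Incident P m × P ≢ G) B) where

    U S : PointSet
    U = unionOfLines ls
    S P = U P ∨ inList B P

    Gm : G ∈ₗ m
    Gm = Incident⇒incident? G∈m

    pencil-complete : ∀ ℓ → G ∈ₗ ℓ → ℓ ≢ m → ℓ ∈ ls
    pencil-complete ℓ Gℓ ℓ≢m with Lines.memberOf⇒∈ ℓ (m ∷ ls) (true-if-not-false (λ ℓ∉M →
        true≢false (∧-intro Gℓ (cong not ℓ∉M)) (Lines.count≡0⇒false (incident? G ∩ ∁ M) ℓ no-other-lines)))
      where
      M : Line → Bool
      M = Lines.memberOf (m ∷ ls)
      M⊆pencil : ∀ ℓ → M ℓ ≡ true → G ∈ₗ ℓ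
      M⊆pencil ℓ e with Lines.memberOf⇒∈ ℓ (m ∷ ls) e
      ... | here refl = Gm
      ... | there ℓ∈ls = Incident⇒incident? (All.lookup G∈ls ℓ∈ls)
      no-other-lines : count (incident? G ∩ ∁ M) lines ≡ 0
      no-other-lines = ℕ.+-cancelˡ-≡ (suc q) _ _ (begin
        suc q + count (incident? G ∩ ∁ M) lines
          ≡⟨ cong (λ n → suc n + count (incident? G ∩ ∁ M) lines) ls-size ⟨
        suc (length ls) + count (incident? G ∩ ∁ M) lines
          ≡⟨ cong (_+ count (incident? G ∩ ∁ M) lines) (Lines.count-memberOf (m ∷ ls) (¬Any⇒All¬ ls m∉ls ∷ ls-unique)) ⟨
        count M lines + count (incident? G ∩ ∁ M) lines
          ≡⟨ cong (_+ count (incident? G ∩ ∁ M) lines) (count-cong _ _ lines λ ℓ → on-M ℓ (M ℓ) refl) ⟩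
        count (incident? G ∩ M) lines + count (incident? G ∩ ∁ M) lines
          ≡⟨ count-split (incident? G) M lines ⟨
        count (incident? G) lines
          ≡⟨ pencil-size G ⟩
        suc q
          ≡⟨ ℕ.+-identityʳ (suc q) ⟨
        suc q + 0 ∎)
        where
        open ≡-Reasoning
        on-M : ∀ ℓ b → M ℓ ≡ b → b ≡ (incident? G ∩ M) ℓ
        on-M ℓ true e rewrite e | M⊆pencil ℓ e = refl
        on-M ℓ false e rewrite e = sym (Bool.∧-zeroʳ (incident? G ℓ))
    ... | here ℓ≡m = ⊥-elim (ℓ≢m ℓ≡m)
    ... | there ℓ∈ls = ℓ∈ls

    G∈U : U G ≡ true
    G∈U = let (ℓ , ℓ∈ls) = some-line ls (subst (1 ≤_) (sym ls-size) (ℕ.≤-trans (s≤s z≤n) 2≤q))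
          in union-contains ls ℓ∈ls (Incident⇒incident? (All.lookup G∈ls ℓ∈ls))
      where
      some-line : ∀ ls → 1 ≤ length ls → Σ Line (_∈ ls)
      some-line (ℓ ∷ _) _ = ℓ , here refl

    off-m⇒∈U : ∀ P → P ∉ₗ m → U P ≡ true
    off-m⇒∈U P Pm = let (ℓ , Pℓ , Gℓ) = join P G P≢G in
      union-contains ls (pencil-complete ℓ Gℓ (λ ℓ≡m → true≢false (subst (P ∈ₗ_) ℓ≡m Pℓ) Pm)) Pℓ
      where
      P≢G : P ≢ G
      P≢G refl = true≢false Gm Pm

    on-m⇒∉U : ∀ P → P ∈ₗ m → P ≢ G → U P ≡ false
    on-m⇒∉U P Pm P≢G = false-if-not-true λ P∈U →
      let (ℓ , ℓ∈ls , Pℓ) = union-witness ls P∈U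
      in m∉ls (subst (_∈ ls) (join-unique P≢G Pℓ (Incident⇒incident? (All.lookup G∈ls ℓ∈ls)) Pm Gm) ℓ∈ls)

    B-on-m : ∀ P → inList B P ≡ true → P ∈ₗ m × P ≢ G
    B-on-m P e = let (Pm , P≢G) = All.lookup B⊆m∖G (Points.memberOf⇒∈ P B e) in Incident⇒incident? Pm , P≢G

    meet-m : meet S m ≡ suc (length B)
    meet-m = begin
      meet S m                                       ≡⟨ count-cong (S ∩ on m) (Points.is G ∪ inList B) points on-m ⟩
      count (Points.is G ∪ inList B) points          ≡⟨ ℕ.+-identityʳ _ ⟨
      count (Points.is G ∪ inList B) points + 0      ≡⟨ cong (count (Points.is G ∪ inList B) points +_) (count-none _ points G∉B) ⟨
      count (Points.is G ∪ inList B) points + count (Points.is G ∩ inList B) points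
                                                     ≡⟨ count-∪+count-∩ (Points.is G) (inList B) points ⟩
      count (Points.is G) points + count (inList B) points
                                                     ≡⟨ cong₂ _+_ (Points.count-is G) (Points.count-memberOf B B-unique) ⟩
      suc (length B)                                 ∎
      where
      open ≡-Reasoning
      G∉B : ∀ P → (Points.is G ∩ inList B) P ≡ false
      G∉B P = false-if-not-true λ e →
        let (P-is-G , P∈B) = ∧-true e in proj₂ (B-on-m P P∈B) (Points.is⇒≡ G P P-is-G)
      on-m : ∀ P → (S ∩ on m) P ≡ (Points.is G ∪ inList B) P
      on-m P with incident? P m in Pm | P ≟P G
      ... | true | yes refl = trans (Bool.∧-identityʳ (S P)) (cong (_∨ inList B P) G∈U)
      ... | true | no P≢G = trans (Bool.∧-identityʳ (S P)) (cong (_∨ inList B P) (on-m⇒∉U P Pm P≢G))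
      ... | false | yes refl = ⊥-elim (true≢false Gm Pm)
      ... | false | no _ = trans (Bool.∧-zeroʳ (S P)) (sym (false-if-not-true λ P∈B → true≢false (proj₁ (B-on-m P P∈B)) Pm))

    size-S : size S ≡ 1 + q ^ 2 + length B
    size-S = begin
      size S                                             ≡⟨ count-split S (on m) points ⟩
      meet S m + count (S ∩ ∁ (on m)) points             ≡⟨ cong₂ _+_ meet-m (count-cong _ (∁ (on m)) points off-m) ⟩
      suc (length B) + count (∁ (on m)) points           ≡⟨ cong (suc (length B) +_) (points-off-line m) ⟩
      suc (length B) + q * q                             ≡⟨ arithmetic (length B) q ⟩
      1 + q * q + length B                               ≡⟨ cong (λ n → 1 + n + length B) (square q) ⟨
      1 + q ^ 2 + length B                               ∎
      where
      open ≡-Reasoning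
      arithmetic : ∀ b q → suc b + q * q ≡ 1 + q * q + b
      arithmetic = solve-∀
      off-m : ∀ P → (S ∩ ∁ (on m)) P ≡ not (incident? P m)
      off-m P with incident? P m in Pm
      ... | true = Bool.∧-zeroʳ (S P)
      ... | false = trans (Bool.∧-identityʳ (S P)) (cong (_∨ inList B P) (off-m⇒∈U P Pm))

    secant : ∀ Q → S Q ≡ false → secantSum S Q ≡ ((length B + 1) C 2) + (q C 2) * q
    secant Q Q∉S = begin
      secantSum S Q                                ≡⟨ secantSum-const-except S Q (q C 2) (m ∷ []) ([] ∷ []) (Qm ∷ []) others ⟩
      meet S m C 2 + 0 + (q C 2) * q               ≡⟨ cong (λ n → n C 2 + 0 + (q C 2) * q) (trans meet-m (ℕ.+-comm 1 (length B))) ⟩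
      (length B + 1) C 2 + 0 + (q C 2) * q         ≡⟨ cong (_+ (q C 2) * q) (ℕ.+-identityʳ _) ⟩
      (length B + 1) C 2 + (q C 2) * q             ∎
      where
      open ≡-Reasoning
      Q∉U = proj₁ (∨-false Q∉S)
      Qm : Q ∈ₗ m
      Qm with incident? Q m in Q?m
      ... | true = refl
      ... | false = ⊥-elim (true≢false (off-m⇒∈U Q Q?m) Q∉U)
      others : ∀ ℓ → Q ∈ₗ ℓ → ℓ ∉ m ∷ [] → multiplicity S ℓ ≡ q C 2
      others ℓ Qℓ ℓ∉m = cong (_C 2) (ℕ.+-cancelʳ-≡ 1 _ _
        (trans (cong (meet S ℓ +_) (sym only-Q)) (trans (meet+outside S ℓ) (ℕ.+-comm 1 q))))
        where
        only-Q : count (on ℓ ∩ ∁ S) points ≡ 1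
        only-Q = Points.count-singleton (on ℓ ∩ ∁ S) Q (∧-intro Qℓ (cong not Q∉S)) λ P e →
          let (Pℓ , P∉S) = ∧-true e in on-m⇒Q P Pℓ (not-true P∉S)
          where
          on-m⇒Q : ∀ P → P ∈ₗ ℓ → S P ≡ false → P ≡ Q
          on-m⇒Q P Pℓ P∉S with incident? P m in Pm
          ... | true = meet-unique (λ ℓ≡m → ℓ∉m (here ℓ≡m)) Pℓ Pm Qℓ Qm
          ... | false = ⊥-elim (true≢false (cong (_∨ inList B P) (off-m⇒∈U P Pm)) P∉S)

  pencil-with-points-optimal : (G : Point) (ls : List Line) (m : Line) (B : List Point) →
    length ls ≡ q → Unique ls → All (Incident G) ls → Incident G m → m ∉ ls →
    1 ≤ length B → length B ≤ q ∸ 1 → Unique B → All (λ P → Incident P m × P ≢ G) B →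
    (size (λ P → unionOfLines ls P ∨ inList B P) ≡ 1 + q ^ 2 + length B)
    × IsOptimalSaturating (λ P → unionOfLines ls P ∨ inList B P) (((length B + 1) C 2) + (q C 2) * q)
  pencil-with-points-optimal G ls m B ls-size ls-unique G∈ls G∈m m∉ls _ |B|≤q-1 B-unique B⊆m∖G =
    size-S , optimal S _ spans (subst₂ _<_ (sym size-S) (sym points-count) small) secant
    where
    open PencilWithPoints G ls m B ls-size ls-unique G∈ls G∈m m∉ls B-unique B⊆m∖G
    spans : Spans S
    spans = spans-union S ls ls-unique (subst (2 ≤_) (sym ls-size) 2≤q)
      (λ P ℓ ℓ∈ls Pℓ → cong (_∨ inList B P) (union-contains ls ℓ∈ls Pℓ))
    small : 1 + q ^ 2 + length B < suc (q + q * q)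
    small = subst (λ n → 1 + n + length B < suc (q + q * q)) (sym (square q)) (arithmetic q (length B) 2≤q |B|≤q-1)
      where
      arithmetic : ∀ q b → 2 ≤ q → b ≤ q ∸ 1 → 1 + q * q + b < suc (q + q * q)
      arithmetic (suc q′) b _ b≤q′ = s≤s (s≤s (subst (suc q′ * suc q′ + b ≤_) (ℕ.+-comm (suc q′ * suc q′) q′)
        (ℕ.+-monoʳ-≤ (suc q′ * suc q′) b≤q′)))

  module Triangle (ℓ₁ ℓ₂ ℓ₃ : Line) (nc : NonConcurrent ℓ₁ ℓ₂ ℓ₃) where

    T VT : PointSet
    T = triangle ℓ₁ ℓ₂ ℓ₃
    VT = vertexlessTriangle ℓ₁ ℓ₂ ℓ₃

    not-on-all : ∀ {P} → P ∈ₗ ℓ₁ → P ∈ₗ ℓ₂ → P ∈ₗ ℓ₃ → ⊥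
    not-on-all P₁ P₂ P₃ = nc (_ , incident?⇒Incident P₁ , incident?⇒Incident P₂ , incident?⇒Incident P₃)

    distinct : ∀ {a b c} → (∀ {P} → P ∈ₗ a → P ∈ₗ b → P ∈ₗ c → ⊥) → a ≢ b
    distinct {a} {b} {c} none refl with a ≟L c
    ... | yes refl = let (P , Pa) = point-on a in none Pa Pa Pa
    ... | no a≢c = let (P , Pa , Pc) = intersection a c a≢c in none Pa Pa Pc

    ℓ₁≢ℓ₂ : ℓ₁ ≢ ℓ₂
    ℓ₁≢ℓ₂ = distinct not-on-all
    ℓ₁≢ℓ₃ : ℓ₁ ≢ ℓ₃
    ℓ₁≢ℓ₃ = distinct λ P₁ P₃ P₂ → not-on-all P₁ P₂ P₃
    ℓ₂≢ℓ₃ : ℓ₂ ≢ ℓ₃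
    ℓ₂≢ℓ₃ = distinct λ P₂ P₃ P₁ → not-on-all P₁ P₂ P₃

    V₁₂ V₁₃ V₂₃ : Point
    V₁₂ = proj₁ (intersection ℓ₁ ℓ₂ ℓ₁≢ℓ₂)
    V₁₃ = proj₁ (intersection ℓ₁ ℓ₃ ℓ₁≢ℓ₃)
    V₂₃ = proj₁ (intersection ℓ₂ ℓ₃ ℓ₂≢ℓ₃)

    V₁₂∈ℓ₁ : V₁₂ ∈ₗ ℓ₁
    V₁₂∈ℓ₁ = proj₁ (proj₂ (intersection ℓ₁ ℓ₂ ℓ₁≢ℓ₂))
    V₁₂∈ℓ₂ : V₁₂ ∈ₗ ℓ₂
    V₁₂∈ℓ₂ = proj₂ (proj₂ (intersection ℓ₁ ℓ₂ ℓ₁≢ℓ₂))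
    V₁₂∉ℓ₃ : V₁₂ ∉ₗ ℓ₃
    V₁₂∉ℓ₃ = false-if-not-true (not-on-all V₁₂∈ℓ₁ V₁₂∈ℓ₂)
    V₁₃∈ℓ₁ : V₁₃ ∈ₗ ℓ₁
    V₁₃∈ℓ₁ = proj₁ (proj₂ (intersection ℓ₁ ℓ₃ ℓ₁≢ℓ₃))
    V₁₃∈ℓ₃ : V₁₃ ∈ₗ ℓ₃
    V₁₃∈ℓ₃ = proj₂ (proj₂ (intersection ℓ₁ ℓ₃ ℓ₁≢ℓ₃))
    V₁₃∉ℓ₂ : V₁₃ ∉ₗ ℓ₂
    V₁₃∉ℓ₂ = false-if-not-true λ V₁₃∈ℓ₂ → not-on-all V₁₃∈ℓ₁ V₁₃∈ℓ₂ V₁₃∈ℓ₃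
    V₂₃∈ℓ₂ : V₂₃ ∈ₗ ℓ₂
    V₂₃∈ℓ₂ = proj₁ (proj₂ (intersection ℓ₂ ℓ₃ ℓ₂≢ℓ₃))
    V₂₃∈ℓ₃ : V₂₃ ∈ₗ ℓ₃
    V₂₃∈ℓ₃ = proj₂ (proj₂ (intersection ℓ₂ ℓ₃ ℓ₂≢ℓ₃))
    V₂₃∉ℓ₁ : V₂₃ ∉ₗ ℓ₁
    V₂₃∉ℓ₁ = false-if-not-true λ V₂₃∈ℓ₁ → not-on-all V₂₃∈ℓ₁ V₂₃∈ℓ₂ V₂₃∈ℓ₃

    V₁₂≢V₁₃ : V₁₂ ≢ V₁₃
    V₁₂≢V₁₃ V₁₂≡V₁₃ = true≢false (subst (_∈ₗ ℓ₃) (sym V₁₂≡V₁₃) V₁₃∈ℓ₃) V₁₂∉ℓ₃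
    V₁₂≢V₂₃ : V₁₂ ≢ V₂₃
    V₁₂≢V₂₃ V₁₂≡V₂₃ = true≢false (subst (_∈ₗ ℓ₃) (sym V₁₂≡V₂₃) V₂₃∈ℓ₃) V₁₂∉ℓ₃
    V₁₃≢V₂₃ : V₁₃ ≢ V₂₃
    V₁₃≢V₂₃ V₁₃≡V₂₃ = true≢false (subst (_∈ₗ ℓ₂) (sym V₁₃≡V₂₃) V₂₃∈ℓ₂) V₁₃∉ℓ₂

    -- Counts restricted to an arbitrary mask d: the whole plane, or a single line.
    vertices sides : (Point → Bool) → ℕ
    vertices d = toℕ (d V₁₂) + toℕ (d V₁₃) + toℕ (d V₂₃)
    sides d = count (d ∩ on ℓ₁) points + count (d ∩ on ℓ₂) points + count (d ∩ on ℓ₃) points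

    vertices-on : ∀ ℓ {a b c} → incident? V₁₂ ℓ ≡ a → incident? V₁₃ ℓ ≡ b → incident? V₂₃ ℓ ≡ c →
      vertices (on ℓ) ≡ toℕ a + toℕ b + toℕ c
    vertices-on ℓ refl refl refl = refl

    sides-off : ∀ ℓ → ℓ ≢ ℓ₁ → ℓ ≢ ℓ₂ → ℓ ≢ ℓ₃ → sides (on ℓ) ≡ 3
    sides-off ℓ ℓ≢ℓ₁ ℓ≢ℓ₂ ℓ≢ℓ₃ =
      cong₂ _+_ (cong₂ _+_ (lines-meet-once ℓ ℓ₁ ℓ≢ℓ₁) (lines-meet-once ℓ ℓ₂ ℓ≢ℓ₂)) (lines-meet-once ℓ ℓ₃ ℓ≢ℓ₃)

    no-common-point : ∀ d → count (d ∩ on ℓ₁ ∩ on ℓ₂ ∩ on ℓ₃) points ≡ 0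
    no-common-point d = count-none _ points λ P → false-if-not-true λ e →
      let (P₁ , P₂₃) = ∧-true (proj₂ (∧-true {d P} e)) in not-on-all P₁ (proj₁ (∧-true P₂₃)) (proj₂ (∧-true P₂₃))

    triangle-count : ∀ d → count (d ∩ T) points + vertices d ≡ sides d
    triangle-count d = begin
      count (d ∩ T) points + vertices d
        ≡⟨ cong (count (d ∩ T) points +_) (spread (toℕ (d V₁₂)) _ _) ⟩
      count (d ∩ T) points + (toℕ (d V₁₂) + (toℕ (d V₁₃) + (toℕ (d V₂₃) + 0)))
        ≡⟨ cong (count (d ∩ T) points +_) (cong₂ _+_ (count-at-point d ℓ₁≢ℓ₂ V₁₂∈ℓ₁ V₁₂∈ℓ₂)
             (cong₂ (λ x y → x + (y + 0)) (count-at-point d ℓ₁≢ℓ₃ V₁₃∈ℓ₁ V₁₃∈ℓ₃)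
                                           (count-at-point d ℓ₂≢ℓ₃ V₂₃∈ℓ₂ V₂₃∈ℓ₃))) ⟨
      Σcount (d ∩ T ∷ d ∩ on ℓ₁ ∩ on ℓ₂ ∷ d ∩ on ℓ₁ ∩ on ℓ₃ ∷ d ∩ on ℓ₂ ∩ on ℓ₃ ∷ []) points
        ≡⟨ inclusion-exclusion₃ d (on ℓ₁) (on ℓ₂) (on ℓ₃) points ⟩
      count (d ∩ on ℓ₁) points + (count (d ∩ on ℓ₂) points + (count (d ∩ on ℓ₃) points
        + (count (d ∩ on ℓ₁ ∩ on ℓ₂ ∩ on ℓ₃) points + 0)))
        ≡⟨ cong (λ n → count (d ∩ on ℓ₁) points + (count (d ∩ on ℓ₂) points + (count (d ∩ on ℓ₃) points + (n + 0))))
                (no-common-point d) ⟩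
      count (d ∩ on ℓ₁) points + (count (d ∩ on ℓ₂) points + (count (d ∩ on ℓ₃) points + 0))
        ≡⟨ spread (count (d ∩ on ℓ₁) points) _ _ ⟨
      sides d ∎
      where
      open ≡-Reasoning
      spread : ∀ a b c → a + b + c ≡ a + (b + (c + 0))
      spread = solve-∀

    vertexless-count : ∀ d → count (d ∩ VT) points + 2 * vertices d ≡ sides d
    vertexless-count d = begin
      count (d ∩ VT) points + 2 * vertices d
        ≡⟨ cong (count (d ∩ VT) points +_) (spread (toℕ (d V₁₂)) _ _) ⟩
      count (d ∩ VT) points + (v₁₂ + (v₁₂ + (v₁₃ + (v₁₃ + (v₂₃ + (v₂₃ + 0))))))
        ≡⟨ cong (count (d ∩ VT) points +_) (cong₂ _+_ c₁₂ (cong₂ _+_ c₁₂ (cong₂ _+_ c₁₃ (cong₂ _+_ c₁₃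
             (cong₂ (λ x y → x + (y + 0)) c₂₃ c₂₃))))) ⟨
      Σcount (d ∩ VT ∷ d ∩ on ℓ₁ ∩ on ℓ₂ ∷ d ∩ on ℓ₁ ∩ on ℓ₂ ∷ d ∩ on ℓ₁ ∩ on ℓ₃ ∷ d ∩ on ℓ₁ ∩ on ℓ₃
             ∷ d ∩ on ℓ₂ ∩ on ℓ₃ ∷ d ∩ on ℓ₂ ∩ on ℓ₃ ∷ []) points
        ≡⟨ exactly-one-exclusion₃ d (on ℓ₁) (on ℓ₂) (on ℓ₃) points ⟩
      count (d ∩ on ℓ₁) points + (count (d ∩ on ℓ₂) points + (count (d ∩ on ℓ₃) points
        + (n₀ + (n₀ + (n₀ + 0)))))
        ≡⟨ cong (λ n → count (d ∩ on ℓ₁) points + (count (d ∩ on ℓ₂) points + (count (d ∩ on ℓ₃) points + (n + (n + (n + 0))))))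
                (no-common-point d) ⟩
      count (d ∩ on ℓ₁) points + (count (d ∩ on ℓ₂) points + (count (d ∩ on ℓ₃) points + 0))
        ≡⟨ spread′ (count (d ∩ on ℓ₁) points) _ _ ⟨
      sides d ∎
      where
      open ≡-Reasoning
      n₀ = count (d ∩ on ℓ₁ ∩ on ℓ₂ ∩ on ℓ₃) points
      v₁₂ = toℕ (d V₁₂)
      v₁₃ = toℕ (d V₁₃)
      v₂₃ = toℕ (d V₂₃)
      c₁₂ = count-at-point d ℓ₁≢ℓ₂ V₁₂∈ℓ₁ V₁₂∈ℓ₂
      c₁₃ = count-at-point d ℓ₁≢ℓ₃ V₁₃∈ℓ₁ V₁₃∈ℓ₃
      c₂₃ = count-at-point d ℓ₂≢ℓ₃ V₂₃∈ℓ₂ V₂₃∈ℓ₃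
      spread : ∀ a b c → 2 * (a + b + c) ≡ a + (a + (b + (b + (c + (c + 0)))))
      spread = solve-∀
      spread′ : ∀ a b c → a + b + c ≡ a + (b + (c + 0))
      spread′ = solve-∀

    everywhere : Point → Bool
    everywhere _ = true

    sides-everywhere : sides everywhere ≡ suc q + suc q + suc q
    sides-everywhere = cong₂ _+_ (cong₂ _+_ (line-size ℓ₁) (line-size ℓ₂)) (line-size ℓ₃)

    size-T : size T ≡ 3 * q
    size-T = ℕ.+-cancelʳ-≡ 3 _ _ (trans (triangle-count everywhere) (trans sides-everywhere (arithmetic q)))
      where
      arithmetic : ∀ q → suc q + suc q + suc q ≡ 3 * q + 3
      arithmetic = solve-∀

    meet-T : ∀ ℓ {k} → ℓ ≢ ℓ₁ → ℓ ≢ ℓ₂ → ℓ ≢ ℓ₃ → vertices (on ℓ) ≡ k → meet T ℓ + k ≡ 3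
    meet-T ℓ ℓ≢ℓ₁ ℓ≢ℓ₂ ℓ≢ℓ₃ refl = begin
      meet T ℓ + vertices (on ℓ)
        ≡⟨ cong (_+ vertices (on ℓ)) (count-cong (T ∩ on ℓ) (on ℓ ∩ T) points (λ P → Bool.∧-comm (T P) (incident? P ℓ))) ⟩
      count (on ℓ ∩ T) points + vertices (on ℓ)
        ≡⟨ triangle-count (on ℓ) ⟩
      sides (on ℓ)
        ≡⟨ sides-off ℓ ℓ≢ℓ₁ ℓ≢ℓ₂ ℓ≢ℓ₃ ⟩
      3 ∎
      where open ≡-Reasoning

    module OutsideTriangle (Q : Point) (Q∉T : T Q ≡ false) where
      Q∉sides = anyOf₃-false {incident? Q ℓ₁} {incident? Q ℓ₂} {incident? Q ℓ₃} Q∉T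
      Q∉ℓ₁ = proj₁ Q∉sides
      Q∉ℓ₂ = proj₁ (proj₂ Q∉sides)
      Q∉ℓ₃ = proj₂ (proj₂ Q∉sides)
      Q≢V₁₂ = ≢-sym (distinct-points V₁₂∈ℓ₁ Q∉ℓ₁)
      Q≢V₁₃ = ≢-sym (distinct-points V₁₃∈ℓ₁ Q∉ℓ₁)
      Q≢V₂₃ = ≢-sym (distinct-points V₂₃∈ℓ₂ Q∉ℓ₂)
      m₁₂ = proj₁ (join Q V₁₂ Q≢V₁₂)
      Qm₁₂ = proj₁ (proj₂ (join Q V₁₂ Q≢V₁₂))
      V₁₂m₁₂ = proj₂ (proj₂ (join Q V₁₂ Q≢V₁₂))
      m₁₃ = proj₁ (join Q V₁₃ Q≢V₁₃)
      Qm₁₃ = proj₁ (proj₂ (join Q V₁₃ Q≢V₁₃))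
      V₁₃m₁₃ = proj₂ (proj₂ (join Q V₁₃ Q≢V₁₃))
      m₂₃ = proj₁ (join Q V₂₃ Q≢V₂₃)
      Qm₂₃ = proj₁ (proj₂ (join Q V₂₃ Q≢V₂₃))
      V₂₃m₂₃ = proj₂ (proj₂ (join Q V₂₃ Q≢V₂₃))
      V₁₃∉m₁₂ = join-avoids V₁₂≢V₁₃ V₁₂∈ℓ₁ V₁₃∈ℓ₁ Q∉ℓ₁ Qm₁₂ V₁₂m₁₂
      V₂₃∉m₁₂ = join-avoids V₁₂≢V₂₃ V₁₂∈ℓ₂ V₂₃∈ℓ₂ Q∉ℓ₂ Qm₁₂ V₁₂m₁₂
      V₁₂∉m₁₃ = join-avoids (≢-sym V₁₂≢V₁₃) V₁₃∈ℓ₁ V₁₂∈ℓ₁ Q∉ℓ₁ Qm₁₃ V₁₃m₁₃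
      V₂₃∉m₁₃ = join-avoids V₁₃≢V₂₃ V₁₃∈ℓ₃ V₂₃∈ℓ₃ Q∉ℓ₃ Qm₁₃ V₁₃m₁₃
      V₁₂∉m₂₃ = join-avoids (≢-sym V₁₂≢V₂₃) V₂₃∈ℓ₂ V₁₂∈ℓ₂ Q∉ℓ₂ Qm₂₃ V₂₃m₂₃
      V₁₃∉m₂₃ = join-avoids (≢-sym V₁₃≢V₂₃) V₂₃∈ℓ₃ V₁₃∈ℓ₃ Q∉ℓ₃ Qm₂₃ V₂₃m₂₃
      ms-unique : Unique (m₁₂ ∷ m₁₃ ∷ m₂₃ ∷ [])
      ms-unique = (≢-sym (distinct-lines V₁₃m₁₃ V₁₃∉m₁₂) ∷ ≢-sym (distinct-lines V₂₃m₂₃ V₂₃∉m₁₂) ∷ [])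
                ∷ (≢-sym (distinct-lines V₂₃m₂₃ V₂₃∉m₁₃) ∷ []) ∷ [] ∷ []
      meet-T-through-Q : ∀ ℓ {k} → Q ∈ₗ ℓ → vertices (on ℓ) ≡ k → meet T ℓ + k ≡ 3
      meet-T-through-Q ℓ Qℓ = meet-T ℓ (distinct-lines Qℓ Q∉ℓ₁) (distinct-lines Qℓ Q∉ℓ₂) (distinct-lines Qℓ Q∉ℓ₃)
      two-points : ∀ ℓ → Q ∈ₗ ℓ → vertices (on ℓ) ≡ 1 → meet T ℓ ≡ 2
      two-points ℓ Qℓ one = ℕ.+-cancelʳ-≡ 1 _ _ (meet-T-through-Q ℓ Qℓ one)
      others : ∀ ℓ → Q ∈ₗ ℓ → ℓ ∉ m₁₂ ∷ m₁₃ ∷ m₂₃ ∷ [] → multiplicity T ℓ ≡ 3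
      others ℓ Qℓ ℓ∉ms = cong (_C 2) (trans (sym (ℕ.+-identityʳ (meet T ℓ))) (meet-T-through-Q ℓ Qℓ
        (vertices-on ℓ (off-other-line Q≢V₁₂ Qm₁₂ V₁₂m₁₂ Qℓ (λ e → ℓ∉ms (here e)))
                       (off-other-line Q≢V₁₃ Qm₁₃ V₁₃m₁₃ Qℓ (λ e → ℓ∉ms (there (here e))))
                       (off-other-line Q≢V₂₃ Qm₂₃ V₂₃m₂₃ Qℓ (λ e → ℓ∉ms (there (there (here e))))))))
      arithmetic : ∀ q → 2 ≤ q → 3 + 3 * (suc q ∸ 3) ≡ 3 * (q ∸ 1)
      arithmetic (suc zero) (s≤s ())
      arithmetic (suc (suc k)) _ = solve-k k
        where
        solve-k : ∀ k → 3 + 3 * k ≡ 3 * suc k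
        solve-k = solve-∀

      secantSum-T : secantSum T Q ≡ 3 * (q ∸ 1)
      secantSum-T = begin
        secantSum T Q
          ≡⟨ secantSum-const-except T Q 3 (m₁₂ ∷ m₁₃ ∷ m₂₃ ∷ []) ms-unique (Qm₁₂ ∷ Qm₁₃ ∷ Qm₂₃ ∷ []) others ⟩
        meet T m₁₂ C 2 + (meet T m₁₃ C 2 + (meet T m₂₃ C 2 + 0)) + 3 * (suc q ∸ 3)
          ≡⟨ cong₂ (λ x y → x C 2 + (y C 2 + (meet T m₂₃ C 2 + 0)) + 3 * (suc q ∸ 3))
                   (two-points m₁₂ Qm₁₂ (vertices-on m₁₂ V₁₂m₁₂ V₁₃∉m₁₂ V₂₃∉m₁₂))
                   (two-points m₁₃ Qm₁₃ (vertices-on m₁₃ V₁₂∉m₁₃ V₁₃m₁₃ V₂₃∉m₁₃)) ⟩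
        1 + (1 + (meet T m₂₃ C 2 + 0)) + 3 * (suc q ∸ 3)
          ≡⟨ cong (λ z → 1 + (1 + (z C 2 + 0)) + 3 * (suc q ∸ 3))
                  (two-points m₂₃ Qm₂₃ (vertices-on m₂₃ V₁₂∉m₂₃ V₁₃∉m₂₃ V₂₃m₂₃)) ⟩
        3 + 3 * (suc q ∸ 3)
          ≡⟨ arithmetic q 2≤q ⟩
        3 * (q ∸ 1) ∎
        where open ≡-Reasoning

    secant-T : ∀ Q → T Q ≡ false → secantSum T Q ≡ 3 * (q ∸ 1)
    secant-T = OutsideTriangle.secantSum-T

    S₄ : PointSet
    S₄ P = not (VT P)

    meet-S₄ : ∀ ℓ {k s} → vertices (on ℓ) ≡ k → sides (on ℓ) ≡ s → meet S₄ ℓ + s ≡ suc q + 2 * k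
    meet-S₄ ℓ refl refl = begin
      meet S₄ ℓ + sides (on ℓ)
        ≡⟨ cong (meet S₄ ℓ +_) (vertexless-count (on ℓ)) ⟨
      meet S₄ ℓ + (count (on ℓ ∩ VT) points + 2 * vertices (on ℓ))
        ≡⟨ ℕ.+-assoc (meet S₄ ℓ) _ _ ⟨
      meet S₄ ℓ + count (on ℓ ∩ VT) points + 2 * vertices (on ℓ)
        ≡⟨ cong (λ n → meet S₄ ℓ + n + 2 * vertices (on ℓ))
                (count-cong _ _ points λ P → cong (incident? P ℓ ∧_) (sym (Bool.not-involutive (VT P)))) ⟩
      meet S₄ ℓ + count (on ℓ ∩ ∁ S₄) points + 2 * vertices (on ℓ)
        ≡⟨ cong (_+ 2 * vertices (on ℓ)) (meet+outside S₄ ℓ) ⟩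
      suc q + 2 * vertices (on ℓ) ∎
      where open ≡-Reasoning

    sides-on-ℓ₁ : sides (on ℓ₁) ≡ suc q + 1 + 1
    sides-on-ℓ₁ = cong₂ _+_ (cong₂ _+_ (trans (count-cong _ (on ℓ₁) points (λ P → Bool.∧-idem (incident? P ℓ₁))) (line-size ℓ₁))
      (lines-meet-once ℓ₁ ℓ₂ ℓ₁≢ℓ₂)) (lines-meet-once ℓ₁ ℓ₃ ℓ₁≢ℓ₃)

    module OnSide₁ (Q : Point) (Q∈ℓ₁ : Q ∈ₗ ℓ₁) (Q∉ℓ₂ : Q ∉ₗ ℓ₂) (Q∉ℓ₃ : Q ∉ₗ ℓ₃) where
      Q≢V₁₂ = ≢-sym (distinct-points V₁₂∈ℓ₂ Q∉ℓ₂)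
      Q≢V₁₃ = ≢-sym (distinct-points V₁₃∈ℓ₃ Q∉ℓ₃)
      Q≢V₂₃ = ≢-sym (distinct-points V₂₃∈ℓ₂ Q∉ℓ₂)
      m = proj₁ (join Q V₂₃ Q≢V₂₃)
      Qm = proj₁ (proj₂ (join Q V₂₃ Q≢V₂₃))
      V₂₃m = proj₂ (proj₂ (join Q V₂₃ Q≢V₂₃))
      ℓ₁≢m : ℓ₁ ≢ m
      ℓ₁≢m = ≢-sym (distinct-lines V₂₃m V₂₃∉ℓ₁)
      meet-ℓ₁ : meet S₄ ℓ₁ ≡ 2
      meet-ℓ₁ = ℕ.+-cancelʳ-≡ (suc q + 1 + 1) _ _
        (trans (meet-S₄ ℓ₁ (vertices-on ℓ₁ V₁₂∈ℓ₁ V₁₃∈ℓ₁ V₂₃∉ℓ₁) sides-on-ℓ₁) (arithmetic q))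
        where
        arithmetic : ∀ q → suc q + 2 * 2 ≡ 2 + (suc q + 1 + 1)
        arithmetic = solve-∀
      meet-m : meet S₄ m ≡ q
      meet-m = ℕ.+-cancelʳ-≡ 3 _ _ (trans (meet-S₄ m
        (vertices-on m (join-avoids (≢-sym V₁₂≢V₂₃) V₂₃∈ℓ₂ V₁₂∈ℓ₂ Q∉ℓ₂ Qm V₂₃m)
                       (join-avoids (≢-sym V₁₃≢V₂₃) V₂₃∈ℓ₃ V₁₃∈ℓ₃ Q∉ℓ₃ Qm V₂₃m) V₂₃m)
        (sides-off m (≢-sym ℓ₁≢m) (distinct-lines Qm Q∉ℓ₂) (distinct-lines Qm Q∉ℓ₃))) (arithmetic q))
        where
        arithmetic : ∀ q → suc q + 2 * 1 ≡ q + 3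
        arithmetic = solve-∀
      others : ∀ ℓ → Q ∈ₗ ℓ → ℓ ∉ ℓ₁ ∷ m ∷ [] → multiplicity S₄ ℓ ≡ (q ∸ 2) C 2
      others ℓ Qℓ ℓ∉ms = cong (_C 2) (ℕ.+-cancelʳ-≡ 3 _ _ (trans (meet-S₄ ℓ
        (vertices-on ℓ (off-other-line Q≢V₁₂ Q∈ℓ₁ V₁₂∈ℓ₁ Qℓ ℓ≢ℓ₁)
                       (off-other-line Q≢V₁₃ Q∈ℓ₁ V₁₃∈ℓ₁ Qℓ ℓ≢ℓ₁)
                       (off-other-line Q≢V₂₃ Qm V₂₃m Qℓ (λ e → ℓ∉ms (there (here e)))))
        (sides-off ℓ ℓ≢ℓ₁ (distinct-lines Qℓ Q∉ℓ₂) (distinct-lines Qℓ Q∉ℓ₃))) (arithmetic q 2≤q)))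
        where
        ℓ≢ℓ₁ : ℓ ≢ ℓ₁
        ℓ≢ℓ₁ e = ℓ∉ms (here e)
        arithmetic : ∀ q → 2 ≤ q → suc q + 2 * 0 ≡ q ∸ 2 + 3
        arithmetic (suc zero) (s≤s ())
        arithmetic (suc (suc k)) _ = solve-k k
          where
          solve-k : ∀ k → suc (suc (suc k)) + 2 * 0 ≡ k + 3
          solve-k = solve-∀

      secantSum-S₄ : secantSum S₄ Q ≡ 1 + (q C 2) + (q ∸ 1) * ((q ∸ 2) C 2)
      secantSum-S₄ = begin
        secantSum S₄ Q
          ≡⟨ secantSum-const-except S₄ Q ((q ∸ 2) C 2) (ℓ₁ ∷ m ∷ []) ((ℓ₁≢m ∷ []) ∷ [] ∷ []) (Q∈ℓ₁ ∷ Qm ∷ []) others ⟩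
        meet S₄ ℓ₁ C 2 + (meet S₄ m C 2 + 0) + ((q ∸ 2) C 2) * (q ∸ 1)
          ≡⟨ cong₂ (λ x y → x C 2 + (y C 2 + 0) + ((q ∸ 2) C 2) * (q ∸ 1)) meet-ℓ₁ meet-m ⟩
        1 + ((q C 2) + 0) + ((q ∸ 2) C 2) * (q ∸ 1)
          ≡⟨ cong₂ (λ x y → 1 + x + y) (ℕ.+-identityʳ (q C 2)) (ℕ.*-comm ((q ∸ 2) C 2) (q ∸ 1)) ⟩
        1 + (q C 2) + (q ∸ 1) * ((q ∸ 2) C 2) ∎
        where open ≡-Reasoning

    secant-S₄-side₁ : ∀ Q → Q ∈ₗ ℓ₁ → Q ∉ₗ ℓ₂ → Q ∉ₗ ℓ₃ → secantSum S₄ Q ≡ 1 + (q C 2) + (q ∸ 1) * ((q ∸ 2) C 2)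
    secant-S₄-side₁ = OnSide₁.secantSum-S₄

    spans-T : Spans T
    spans-T = spans-two-lines T ℓ₁ ℓ₂ ℓ₁≢ℓ₂ (λ P → union-contains (ℓ₁ ∷ ℓ₂ ∷ ℓ₃ ∷ []) (here refl))
                                         (λ P → union-contains (ℓ₁ ∷ ℓ₂ ∷ ℓ₃ ∷ []) (there (here refl)))
    T-small : size T < length points
    T-small = subst₂ _<_ (sym size-T) (sym points-count) (arithmetic q 2≤q)
      where
      arithmetic : ∀ q → 2 ≤ q → 3 * q < suc (q + q * q)
      arithmetic (suc zero) (s≤s ())
      arithmetic (suc (suc k)) _ = s≤s (subst (3 * suc (suc k) ≤_) (solve-k k) (ℕ.m≤m+n (3 * suc (suc k)) (k * k + 2 * k)))
        where
        solve-k : ∀ k → 3 * suc (suc k) + (k * k + 2 * k) ≡ suc (suc k) + suc (suc k) * suc (suc k)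
        solve-k = solve-∀

    q²∸2q : ∀ k → suc (suc k) ^ 2 ∸ 2 * suc (suc k) ≡ k * k + 2 * k
    q²∸2q k = trans (cong (_∸ 2 * suc (suc k)) (trans (square (suc (suc k))) (solve-k k))) (ℕ.m+n∸n≡m (k * k + 2 * k) (2 * suc (suc k)))
      where
      solve-k : ∀ k → suc (suc k) * suc (suc k) ≡ k * k + 2 * k + 2 * suc (suc k)
      solve-k = solve-∀
    size-S₄ : size S₄ ≡ q ^ 2 ∸ 2 * q + 4
    size-S₄ = arithmetic q 2≤q (trans (count+count-∁ VT points) points-count) (trans (vertexless-count everywhere) sides-everywhere)
      where
      arithmetic : ∀ q → 2 ≤ q → count VT points + size S₄ ≡ suc (q + q * q) → count VT points + 2 * 3 ≡ suc q + suc q + suc q →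
        size S₄ ≡ q ^ 2 ∸ 2 * q + 4
      arithmetic (suc zero) (s≤s ()) _ _
      arithmetic (suc (suc k)) _ total vt = begin
        size S₄
          ≡⟨ ℕ.+-cancelˡ-≡ (count VT points) _ _ (trans total (trans (solve-k k) (cong (_+ (k * k + 2 * k + 4)) vt′))) ⟩
        k * k + 2 * k + 4
          ≡⟨ cong (_+ 4) (q²∸2q k) ⟨
        suc (suc k) ^ 2 ∸ 2 * suc (suc k) + 4 ∎
        where
        open ≡-Reasoning
        solve-k : ∀ k → suc (suc (suc k) + suc (suc k) * suc (suc k)) ≡ 3 * k + 3 + (k * k + 2 * k + 4)
        solve-k = solve-∀
        solve-k′ : ∀ k → suc (suc (suc k)) + suc (suc (suc k)) + suc (suc (suc k)) ≡ 3 * k + 3 + 2 * 3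
        solve-k′ = solve-∀
        vt′ : 3 * k + 3 ≡ count VT points
        vt′ = sym (ℕ.+-cancelʳ-≡ (2 * 3) _ _ (trans vt (solve-k′ k)))
    vertex∈S₄ : ∀ {V a b c} → incident? V ℓ₁ ≡ a → incident? V ℓ₂ ≡ b → incident? V ℓ₃ ≡ c → exactlyOne a b c ≡ false → S₄ V ≡ true
    vertex∈S₄ refl refl refl e = cong not e
    spans-S₄ : Spans S₄
    spans-S₄ (ℓ , S₄⊆ℓ) = true≢false (subst (V₂₃ ∈ₗ_) ℓ≡ℓ₁ V₂₃ℓ) V₂₃∉ℓ₁
      where
      on-ℓ : ∀ {V a b c} → incident? V ℓ₁ ≡ a → incident? V ℓ₂ ≡ b → incident? V ℓ₃ ≡ c → exactlyOne a b c ≡ false → V ∈ₗ ℓ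
      on-ℓ e₁ e₂ e₃ e = Incident⇒incident? (S₄⊆ℓ _ (vertex∈S₄ e₁ e₂ e₃ e))
      V₂₃ℓ = on-ℓ V₂₃∉ℓ₁ V₂₃∈ℓ₂ V₂₃∈ℓ₃ refl
      ℓ≡ℓ₁ : ℓ ≡ ℓ₁
      ℓ≡ℓ₁ = join-unique V₁₂≢V₁₃ (on-ℓ V₁₂∈ℓ₁ V₁₂∈ℓ₂ V₁₂∉ℓ₃ refl) (on-ℓ V₁₃∈ℓ₁ V₁₃∉ℓ₂ V₁₃∈ℓ₃ refl)
                         V₁₂∈ℓ₁ V₁₃∈ℓ₁
    S₄-small : size S₄ < length points
    S₄-small = subst₂ _<_ (sym size-S₄) (sym points-count) (arithmetic q 2≤q)
      where
      arithmetic : ∀ q → 2 ≤ q → q ^ 2 ∸ 2 * q + 4 < suc (q + q * q)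
      arithmetic (suc zero) (s≤s ())
      arithmetic (suc (suc k)) _ rewrite q²∸2q k =
        s≤s (subst (k * k + 2 * k + 4 ≤_) (solve-k k) (ℕ.m≤m+n (k * k + 2 * k + 4) (3 * k + 2)))
        where
        solve-k : ∀ k → k * k + 2 * k + 4 + (3 * k + 2) ≡ suc (suc k) + suc (suc k) * suc (suc k)
        solve-k = solve-∀

  -- S₄ is symmetric in the three sides, so it suffices to treat points on ℓ₁ only.
  secant-S₄ : ∀ ℓ₁ ℓ₂ ℓ₃ (nc : NonConcurrent ℓ₁ ℓ₂ ℓ₃) Q → Triangle.S₄ ℓ₁ ℓ₂ ℓ₃ nc Q ≡ false →
    secantSum (Triangle.S₄ ℓ₁ ℓ₂ ℓ₃ nc) Q ≡ 1 + (q C 2) + (q ∸ 1) * ((q ∸ 2) C 2)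
  secant-S₄ ℓ₁ ℓ₂ ℓ₃ nc Q Q∉S₄ with exactlyOne-cases (incident? Q ℓ₁) (incident? Q ℓ₂) (incident? Q ℓ₃) (not-false Q∉S₄)
  ... | inj₁ (a , b , c) = Triangle.secant-S₄-side₁ ℓ₁ ℓ₂ ℓ₃ nc Q a b c
  ... | inj₂ (inj₁ (a , b , c)) =
    trans (secantSum-cong _ _ Q (λ P → cong not (sym (exactlyOne-swap (incident? P ℓ₁) (incident? P ℓ₂) (incident? P ℓ₃)))))
          (Triangle.secant-S₄-side₁ ℓ₂ ℓ₁ ℓ₃ (λ (P , x , y , z) → nc (P , y , x , z)) Q b a c)
  ... | inj₂ (inj₂ (a , b , c)) =
    trans (secantSum-cong _ _ Q (λ P → cong not (exactlyOne-rotate (incident? P ℓ₃) (incident? P ℓ₁) (incident? P ℓ₂))))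
          (Triangle.secant-S₄-side₁ ℓ₃ ℓ₁ ℓ₂ (λ (P , x , y , z) → nc (P , y , z , x)) Q c a b)

  triangle-optimal : (ℓ₁ ℓ₂ ℓ₃ : Line) → NonConcurrent ℓ₁ ℓ₂ ℓ₃ →
    (size (triangle ℓ₁ ℓ₂ ℓ₃) ≡ 3 * q) × IsOptimalSaturating (triangle ℓ₁ ℓ₂ ℓ₃) (3 * (q ∸ 1))
  triangle-optimal ℓ₁ ℓ₂ ℓ₃ nc = size-T , optimal T _ spans-T T-small secant-T
    where open Triangle ℓ₁ ℓ₂ ℓ₃ nc

  vertexless-triangle-complement-optimal : (ℓ₁ ℓ₂ ℓ₃ : Line) → NonConcurrent ℓ₁ ℓ₂ ℓ₃ →
    (size (λ P → not (vertexlessTriangle ℓ₁ ℓ₂ ℓ₃ P)) ≡ q ^ 2 ∸ 2 * q + 4)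
    × IsOptimalSaturating (λ P → not (vertexlessTriangle ℓ₁ ℓ₂ ℓ₃ P)) (1 + (q C 2) + (q ∸ 1) * ((q ∸ 2) C 2))
  vertexless-triangle-complement-optimal ℓ₁ ℓ₂ ℓ₃ nc = size-S₄ , optimal S₄ _ spans-S₄ S₄-small (secant-S₄ ℓ₁ ℓ₂ ℓ₃ nc)
    where open Triangle ℓ₁ ℓ₂ ℓ₃ nc

-- PG(2,K) as a projective plane

-- The ring solver instantiated with integer coefficients: constants such as 1 − 1 then
-- normalise by computation, which fails for coefficients in an abstract field.
module IntegerCoefficients
  {A : Set} {add mul : A → A → A} {neg : A → A} {nil one : A}
  (isCommutativeRing : IsCommutativeRing _≡_ add mul neg nil one) where

  R : CommutativeRing _ _
  R = record { isCommutativeRing = isCommutativeRing }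

  open CommutativeRing R using (0#; 1#; ring; semiring; +-assoc; +-comm; +-identityˡ; +-identityʳ; -‿inverseʳ; -‿cong)
    renaming (_+_ to _+ᴿ_; _*_ to _*ᴿ_; -_ to -ᴿ_)
  open import Algebra.Properties.Ring ring using (-‿involutive; -0#≈0#; -‿+-comm; -‿distribˡ-*; -‿distribʳ-*)
  open import Algebra.Properties.Semiring.Mult.TCOptimised semiring using (×-homo-+; ×1-homo-*; 1+×) renaming (_×_ to _·_)
  open ≡-Reasoning

  fromℤ : ℤ → A
  fromℤ (ℤ.+ n) = n · 1#
  fromℤ -[1+ n ] = -ᴿ (suc n · 1#)

  fromℤ-neg : ∀ i → fromℤ (ℤ.- i) ≡ -ᴿ fromℤ i
  fromℤ-neg (ℤ.+ zero) = sym -0#≈0#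
  fromℤ-neg (ℤ.+ suc n) = refl
  fromℤ-neg -[1+ n ] = sym (-‿involutive _)

  fromℤ-⊖ : ∀ m n → fromℤ (m ⊖ n) ≡ (m · 1#) +ᴿ -ᴿ (n · 1#)
  fromℤ-⊖ m zero = begin
    fromℤ (m ⊖ zero)            ≡⟨ cong fromℤ (ℤ.≤-⊖ {0} {m} z≤n) ⟩
    m · 1#                      ≡⟨ +-identityʳ _ ⟨
    (m · 1#) +ᴿ 0#              ≡⟨ cong ((m · 1#) +ᴿ_) -0#≈0# ⟨
    (m · 1#) +ᴿ -ᴿ 0#           ∎
  fromℤ-⊖ zero (suc n) = sym (+-identityˡ _)
  fromℤ-⊖ (suc m) (suc n) = begin
    fromℤ (suc m ⊖ suc n)                         ≡⟨ cong fromℤ (ℤ.[1+m]⊖[1+n]≡m⊖n m n) ⟩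
    fromℤ (m ⊖ n)                                 ≡⟨ fromℤ-⊖ m n ⟩
    (m · 1#) +ᴿ -ᴿ (n · 1#)                       ≡⟨ cancel-1 (m · 1#) (n · 1#) ⟨
    (1# +ᴿ m · 1#) +ᴿ -ᴿ (1# +ᴿ n · 1#)           ≡⟨ cong₂ (λ a b → a +ᴿ -ᴿ b) (1+× m 1#) (1+× n 1#) ⟨
    (suc m · 1#) +ᴿ -ᴿ (suc n · 1#)               ∎
    where
    cancel-1 : ∀ a b → (1# +ᴿ a) +ᴿ -ᴿ (1# +ᴿ b) ≡ a +ᴿ -ᴿ b
    cancel-1 a b = begin
      (1# +ᴿ a) +ᴿ -ᴿ (1# +ᴿ b)          ≡⟨ cong ((1# +ᴿ a) +ᴿ_) (-‿+-comm 1# b) ⟨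
      (1# +ᴿ a) +ᴿ (-ᴿ 1# +ᴿ -ᴿ b)       ≡⟨ +-assoc 1# a _ ⟩
      1# +ᴿ (a +ᴿ (-ᴿ 1# +ᴿ -ᴿ b))       ≡⟨ cong (1# +ᴿ_) (+-assoc a _ _) ⟨
      1# +ᴿ ((a +ᴿ -ᴿ 1#) +ᴿ -ᴿ b)       ≡⟨ cong (λ z → 1# +ᴿ (z +ᴿ -ᴿ b)) (+-comm a _) ⟩
      1# +ᴿ ((-ᴿ 1# +ᴿ a) +ᴿ -ᴿ b)       ≡⟨ cong (1# +ᴿ_) (+-assoc _ a _) ⟩
      1# +ᴿ (-ᴿ 1# +ᴿ (a +ᴿ -ᴿ b))       ≡⟨ +-assoc 1# _ _ ⟨
      (1# +ᴿ -ᴿ 1#) +ᴿ (a +ᴿ -ᴿ b)       ≡⟨ cong (_+ᴿ (a +ᴿ -ᴿ b)) (-‿inverseʳ 1#) ⟩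
      0# +ᴿ (a +ᴿ -ᴿ b)                  ≡⟨ +-identityˡ _ ⟩
      a +ᴿ -ᴿ b                          ∎

  fromℤ-+ : ∀ i j → fromℤ (i ℤ.+ j) ≡ fromℤ i +ᴿ fromℤ j
  fromℤ-+ (ℤ.+ m) (ℤ.+ n) = ×-homo-+ 1# m n
  fromℤ-+ (ℤ.+ m) -[1+ n ] = fromℤ-⊖ m (suc n)
  fromℤ-+ -[1+ m ] (ℤ.+ n) = trans (fromℤ-⊖ n (suc m)) (+-comm _ _)
  fromℤ-+ -[1+ m ] -[1+ n ] = begin
    -ᴿ (suc (suc (m + n)) · 1#)               ≡⟨ cong (λ k → -ᴿ (suc k · 1#)) (ℕ.+-suc m n) ⟨
    -ᴿ ((suc m + suc n) · 1#)                 ≡⟨ -‿cong (×-homo-+ 1# (suc m) (suc n)) ⟩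
    -ᴿ ((suc m · 1#) +ᴿ (suc n · 1#))         ≡⟨ -‿+-comm _ _ ⟨
    -ᴿ (suc m · 1#) +ᴿ -ᴿ (suc n · 1#)        ∎

  fromℤ-*-pos : ∀ m j → fromℤ (ℤ.+ m ℤ.* j) ≡ fromℤ (ℤ.+ m) *ᴿ fromℤ j
  fromℤ-*-pos m (ℤ.+ n) = trans (cong fromℤ (sym (ℤ.pos-* m n))) (×1-homo-* m n)
  fromℤ-*-pos m -[1+ n ] = begin
    fromℤ (ℤ.+ m ℤ.* ℤ.- ℤ.+ suc n)          ≡⟨ cong fromℤ (ℤ.neg-distribʳ-* (ℤ.+ m) (ℤ.+ suc n)) ⟨
    fromℤ (ℤ.- (ℤ.+ m ℤ.* ℤ.+ suc n))        ≡⟨ fromℤ-neg (ℤ.+ m ℤ.* ℤ.+ suc n) ⟩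
    -ᴿ fromℤ (ℤ.+ m ℤ.* ℤ.+ suc n)           ≡⟨ -‿cong (fromℤ-*-pos m (ℤ.+ suc n)) ⟩
    -ᴿ ((m · 1#) *ᴿ (suc n · 1#))            ≡⟨ -‿distribʳ-* _ _ ⟩
    (m · 1#) *ᴿ -ᴿ (suc n · 1#)              ∎

  fromℤ-* : ∀ i j → fromℤ (i ℤ.* j) ≡ fromℤ i *ᴿ fromℤ j
  fromℤ-* (ℤ.+ m) j = fromℤ-*-pos m j
  fromℤ-* -[1+ m ] j = begin
    fromℤ (ℤ.- ℤ.+ suc m ℤ.* j)              ≡⟨ cong fromℤ (ℤ.neg-distribˡ-* (ℤ.+ suc m) j) ⟨
    fromℤ (ℤ.- (ℤ.+ suc m ℤ.* j))            ≡⟨ fromℤ-neg (ℤ.+ suc m ℤ.* j) ⟩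
    -ᴿ fromℤ (ℤ.+ suc m ℤ.* j)               ≡⟨ -‿cong (fromℤ-*-pos (suc m) j) ⟩
    -ᴿ ((suc m · 1#) *ᴿ fromℤ j)             ≡⟨ -‿distribˡ-* _ _ ⟩
    -ᴿ (suc m · 1#) *ᴿ fromℤ j               ∎

  ℤ⟶R : CommutativeRing.rawRing ℤ.+-*-commutativeRing -Raw-AlmostCommutative⟶ fromCommutativeRing R
  ℤ⟶R = record { ⟦_⟧ = fromℤ ; +-homo = fromℤ-+ ; *-homo = fromℤ-* ; -‿homo = fromℤ-neg ; 0-homo = refl ; 1-homo = refl }

  ℤ-weaklyDecidable : WeaklyDecidable (Induced-equivalence ℤ⟶R)
  ℤ-weaklyDecidable i j with i ℤ.≟ j
  ... | yes refl = just refl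
  ... | no _ = nothing

  open import Algebra.Solver.Ring (CommutativeRing.rawRing ℤ.+-*-commutativeRing) (fromCommutativeRing R) ℤ⟶R ℤ-weaklyDecidable public
    using (solve; _:=_; con; _:+_; _:*_; :-_; _:-_)

concatMap-map≡cartesianProductWith : ∀ {A B C : Set} (f : A → B → C) xs ys →
  concatMap (λ x → map (f x) ys) xs ≡ cartesianProductWith f xs ys
concatMap-map≡cartesianProductWith f [] ys = refl
concatMap-map≡cartesianProductWith f (x ∷ xs) ys = cong (map (f x) ys ++_) (concatMap-map≡cartesianProductWith f xs ys)

module ProjectiveCoordinates (K : FiniteField) where
  open FiniteField K
  open PG K
  open IntegerCoefficients isCommutativeRing
  open CommutativeRing R using (*-comm; *-identityˡ; *-identityʳ; zeroʳ; +-identityʳ)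

  infixl 6 _-F_

  _-F_ : Carrier → Carrier → Carrier
  a -F b = a +F (-F b)

  cross : Triple → Triple → Triple
  cross ⟨ a₀ , a₁ , a₂ ⟩ ⟨ b₀ , b₁ , b₂ ⟩ =
    ⟨ (a₁ *F b₂) -F (a₂ *F b₁) , (a₂ *F b₀) -F (a₀ *F b₂) , (a₀ *F b₁) -F (a₁ *F b₀) ⟩

  scale : Carrier → Triple → Triple
  scale l ⟨ a₀ , a₁ , a₂ ⟩ = ⟨ l *F a₀ , l *F a₁ , l *F a₂ ⟩

  IsZero : Triple → Set
  IsZero ⟨ a₀ , a₁ , a₂ ⟩ = a₀ ≡ 0F × a₁ ≡ 0F × a₂ ≡ 0F

  ⟨⟩-cong : ∀ {a₀ a₁ a₂ b₀ b₁ b₂} → a₀ ≡ b₀ → a₁ ≡ b₁ → a₂ ≡ b₂ → ⟨ a₀ , a₁ , a₂ ⟩ ≡ ⟨ b₀ , b₁ , b₂ ⟩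
  ⟨⟩-cong refl refl refl = refl

  1≢0 : 1F ≢ 0F
  1≢0 1≡0 = 0≢1 (sym 1≡0)

  -1≢0 : -F 1F ≢ 0F
  -1≢0 -1≡0 = 1≢0 (trans (solve 0 (con 1ℤ := :- (:- con 1ℤ)) refl) (trans (cong -F_ -1≡0) (solve 0 (:- con 0ℤ := con 0ℤ) refl)))

  a-b≡0⇒a≡b : ∀ a b → a -F b ≡ 0F → a ≡ b
  a-b≡0⇒a≡b a b a-b≡0 = begin
    a                   ≡⟨ solve 2 (λ a b → a := a :- b :+ b) refl a b ⟩
    (a -F b) +F b       ≡⟨ cong (_+F b) a-b≡0 ⟩
    0F +F b             ≡⟨ solve 1 (λ b → con 0ℤ :+ b := b) refl b ⟩
    b                   ∎
    where open ≡-Reasoning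

  dot-cross-left : ∀ A B → dot (cross A B) A ≡ 0F
  dot-cross-left ⟨ a₀ , a₁ , a₂ ⟩ ⟨ b₀ , b₁ , b₂ ⟩ = solve 6 (λ a₀ a₁ a₂ b₀ b₁ b₂ →
    (a₁ :* b₂ :- a₂ :* b₁) :* a₀ :+ (a₂ :* b₀ :- a₀ :* b₂) :* a₁ :+ (a₀ :* b₁ :- a₁ :* b₀) :* a₂ := con 0ℤ)
    refl a₀ a₁ a₂ b₀ b₁ b₂

  dot-cross-right : ∀ A B → dot (cross A B) B ≡ 0F
  dot-cross-right ⟨ a₀ , a₁ , a₂ ⟩ ⟨ b₀ , b₁ , b₂ ⟩ = solve 6 (λ a₀ a₁ a₂ b₀ b₁ b₂ →
    (a₁ :* b₂ :- a₂ :* b₁) :* b₀ :+ (a₂ :* b₀ :- a₀ :* b₂) :* b₁ :+ (a₀ :* b₁ :- a₁ :* b₀) :* b₂ := con 0ℤ)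
    refl a₀ a₁ a₂ b₀ b₁ b₂

  dot-scale : ∀ l U V → dot (scale l U) V ≡ l *F dot U V
  dot-scale l ⟨ c₀ , c₁ , c₂ ⟩ ⟨ a₀ , a₁ , a₂ ⟩ = solve 7 (λ l c₀ c₁ c₂ a₀ a₁ a₂ →
    l :* c₀ :* a₀ :+ l :* c₁ :* a₁ :+ l :* c₂ :* a₂ := l :* (c₀ :* a₀ :+ c₁ :* a₁ :+ c₂ :* a₂)) refl l c₀ c₁ c₂ a₀ a₁ a₂

  dot-comm : ∀ A B → dot A B ≡ dot B A
  dot-comm ⟨ a₀ , a₁ , a₂ ⟩ ⟨ b₀ , b₁ , b₂ ⟩ = solve 6 (λ a₀ a₁ a₂ b₀ b₁ b₂ →
    a₀ :* b₀ :+ a₁ :* b₁ :+ a₂ :* b₂ := b₀ :* a₀ :+ b₁ :* a₁ :+ b₂ :* a₂) refl a₀ a₁ a₂ b₀ b₁ b₂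

  -- Lagrange's identity (A × B) × X = (X·A) B − (X·B) A, read at a common zero X of A and B.
  cross-cross-zero : ∀ A B X → dot X A ≡ 0F → dot X B ≡ 0F → IsZero (cross (cross A B) X)
  cross-cross-zero ⟨ a₀ , a₁ , a₂ ⟩ ⟨ b₀ , b₁ , b₂ ⟩ ⟨ x₀ , x₁ , x₂ ⟩ X·A≡0 X·B≡0 =
    vanish (solve 9 (λ a₀ a₁ a₂ b₀ b₁ b₂ x₀ x₁ x₂ →
              (a₂ :* b₀ :- a₀ :* b₂) :* x₂ :- (a₀ :* b₁ :- a₁ :* b₀) :* x₁
                := b₀ :* (x₀ :* a₀ :+ x₁ :* a₁ :+ x₂ :* a₂) :- a₀ :* (x₀ :* b₀ :+ x₁ :* b₁ :+ x₂ :* b₂))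
              refl a₀ a₁ a₂ b₀ b₁ b₂ x₀ x₁ x₂) ,
    vanish (solve 9 (λ a₀ a₁ a₂ b₀ b₁ b₂ x₀ x₁ x₂ →
              (a₀ :* b₁ :- a₁ :* b₀) :* x₀ :- (a₁ :* b₂ :- a₂ :* b₁) :* x₂
                := b₁ :* (x₀ :* a₀ :+ x₁ :* a₁ :+ x₂ :* a₂) :- a₁ :* (x₀ :* b₀ :+ x₁ :* b₁ :+ x₂ :* b₂))
              refl a₀ a₁ a₂ b₀ b₁ b₂ x₀ x₁ x₂) ,
    vanish (solve 9 (λ a₀ a₁ a₂ b₀ b₁ b₂ x₀ x₁ x₂ →
              (a₁ :* b₂ :- a₂ :* b₁) :* x₁ :- (a₂ :* b₀ :- a₀ :* b₂) :* x₀
                := b₂ :* (x₀ :* a₀ :+ x₁ :* a₁ :+ x₂ :* a₂) :- a₂ :* (x₀ :* b₀ :+ x₁ :* b₁ :+ x₂ :* b₂))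
              refl a₀ a₁ a₂ b₀ b₁ b₂ x₀ x₁ x₂)
    where
    vanish : ∀ {t b a} →
      t ≡ (b *F dot ⟨ x₀ , x₁ , x₂ ⟩ ⟨ a₀ , a₁ , a₂ ⟩) -F (a *F dot ⟨ x₀ , x₁ , x₂ ⟩ ⟨ b₀ , b₁ , b₂ ⟩) → t ≡ 0F
    vanish {b = b} {a} e = trans e (trans (cong₂ (λ u v → (b *F u) -F (a *F v)) X·A≡0 X·B≡0)
      (solve 2 (λ b a → b :* con 0ℤ :- a :* con 0ℤ := con 0ℤ) refl b a))

  cross-scale-zero : ∀ l U X → IsZero (cross U X) → IsZero (cross (scale l U) X)
  cross-scale-zero l ⟨ c₀ , c₁ , c₂ ⟩ ⟨ x₀ , x₁ , x₂ ⟩ (e₀ , e₁ , e₂) =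
    scaled e₀ (solve 7 (λ l c₀ c₁ c₂ x₀ x₁ x₂ → l :* c₁ :* x₂ :- l :* c₂ :* x₁ := l :* (c₁ :* x₂ :- c₂ :* x₁)) refl l c₀ c₁ c₂ x₀ x₁ x₂) ,
    scaled e₁ (solve 7 (λ l c₀ c₁ c₂ x₀ x₁ x₂ → l :* c₂ :* x₀ :- l :* c₀ :* x₂ := l :* (c₂ :* x₀ :- c₀ :* x₂)) refl l c₀ c₁ c₂ x₀ x₁ x₂) ,
    scaled e₂ (solve 7 (λ l c₀ c₁ c₂ x₀ x₁ x₂ → l :* c₀ :* x₁ :- l :* c₁ :* x₀ := l :* (c₀ :* x₁ :- c₁ :* x₀)) refl l c₀ c₁ c₂ x₀ x₁ x₂)
    where
    scaled : ∀ {s t} → s ≡ 0F → t ≡ l *F s → t ≡ 0F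
    scaled s≡0 t≡ls = trans t≡ls (trans (cong (l *F_) s≡0) (zeroʳ l))

  u*1-1*v≡u-v : ∀ u v → (u *F 1F) -F (1F *F v) ≡ u -F v
  u*1-1*v≡u-v = solve 2 (λ u v → u :* con 1ℤ :- con 1ℤ :* v := u :- v) refl

  1*v-u*1≡v-u : ∀ u v → (1F *F v) -F (u *F 1F) ≡ v -F u
  1*v-u*1≡v-u = solve 2 (λ u v → con 1ℤ :* v :- u :* con 1ℤ := v :- u) refl

  1*1-u*0≡1 : ∀ u → (1F *F 1F) -F (u *F 0F) ≡ 1F
  1*1-u*0≡1 = solve 1 (λ u → con 1ℤ :* con 1ℤ :- u :* con 0ℤ := con 1ℤ) refl

  1*1-0*u≡1 : ∀ u → (1F *F 1F) -F (0F *F u) ≡ 1F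
  1*1-0*u≡1 = solve 1 (λ u → con 1ℤ :* con 1ℤ :- con 0ℤ :* u := con 1ℤ) refl

  u*0-1*1≡-1 : ∀ u → (u *F 0F) -F (1F *F 1F) ≡ -F 1F
  u*0-1*1≡-1 = solve 1 (λ u → u :* con 0ℤ :- con 1ℤ :* con 1ℤ := :- con 1ℤ) refl

  0*u-1*1≡-1 : ∀ u → (0F *F u) -F (1F *F 1F) ≡ -F 1F
  0*u-1*1≡-1 = solve 1 (λ u → con 0ℤ :* u :- con 1ℤ :* con 1ℤ := :- con 1ℤ) refl

  -- A vanishing cross product means proportional coordinates, and normalised ones then coincide.
  cross-zero⇒≡ : ∀ P P′ → IsZero (cross (pcoords P) (pcoords P′)) → P ≡ P′
  cross-zero⇒≡ (p₁ x y) (p₁ x′ y′) (_ , e₁ , e₂) =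
    cong₂ p₁ (sym (a-b≡0⇒a≡b x′ x (trans (sym (1*v-u*1≡v-u x x′)) e₂))) (a-b≡0⇒a≡b y y′ (trans (sym (u*1-1*v≡u-v y y′)) e₁))
  cross-zero⇒≡ (p₁ x y) (p₂ x′) (_ , _ , e₂) = ⊥-elim (1≢0 (trans (sym (1*1-u*0≡1 x)) e₂))
  cross-zero⇒≡ (p₁ x y) p₃ (_ , e₁ , _) = ⊥-elim (-1≢0 (trans (sym (u*0-1*1≡-1 y)) e₁))
  cross-zero⇒≡ (p₂ x) (p₁ x′ y′) (_ , _ , e₂) = ⊥-elim (-1≢0 (trans (sym (0*u-1*1≡-1 x′)) e₂))
  cross-zero⇒≡ (p₂ x) (p₂ x′) (e₀ , _ , _) = cong p₂ (sym (a-b≡0⇒a≡b x′ x (trans (sym (1*v-u*1≡v-u x x′)) e₀)))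
  cross-zero⇒≡ (p₂ x) p₃ (e₀ , _ , _) = ⊥-elim (1≢0 (trans (sym (1*1-u*0≡1 x)) e₀))
  cross-zero⇒≡ p₃ (p₁ x′ y′) (_ , e₁ , _) = ⊥-elim (1≢0 (trans (sym (1*1-0*u≡1 y′)) e₁))
  cross-zero⇒≡ p₃ (p₂ x′) (e₀ , _ , _) = ⊥-elim (-1≢0 (trans (sym (0*u-1*1≡-1 x′)) e₀))
  cross-zero⇒≡ p₃ p₃ _ = refl

  inv-*ˡ : ∀ {c} → c ≢ 0F → inv c *F c ≡ 1F
  inv-*ˡ {c} c≢0 = trans (*-comm (inv c) c) (inverse c c≢0)

  normalise : ∀ c → ¬ IsZero c → Σ Point (λ X → Σ Carrier (λ l → pcoords X ≡ scale l c))
  normalise ⟨ c₀ , c₁ , c₂ ⟩ c≢0 with c₀ ≟F 0F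
  ... | no c₀≢0 = p₁ (c₁ *F inv c₀) (c₂ *F inv c₀) , inv c₀ , ⟨⟩-cong (sym (inv-*ˡ c₀≢0)) (*-comm _ _) (*-comm _ _)
  ... | yes refl with c₁ ≟F 0F
  ... | no c₁≢0 = p₂ (c₂ *F inv c₁) , inv c₁ , ⟨⟩-cong (sym (zeroʳ (inv c₁))) (sym (inv-*ˡ c₁≢0)) (*-comm _ _)
  ... | yes refl with c₂ ≟F 0F
  ... | no c₂≢0 = p₃ , inv c₂ , ⟨⟩-cong (sym (zeroʳ (inv c₂))) (sym (zeroʳ (inv c₂))) (sym (inv-*ˡ c₂≢0))
  ... | yes refl = ⊥-elim (c≢0 (refl , refl , refl))

  toLine : Point → Line
  toLine (p₁ x y) = l₁ x y
  toLine (p₂ x) = l₂ x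
  toLine p₃ = l₃

  toPoint : Line → Point
  toPoint (l₁ x y) = p₁ x y
  toPoint (l₂ x) = p₂ x
  toPoint l₃ = p₃

  lcoords-toLine : ∀ P → lcoords (toLine P) ≡ pcoords P
  lcoords-toLine (p₁ x y) = refl
  lcoords-toLine (p₂ x) = refl
  lcoords-toLine p₃ = refl

  toLine-toPoint : ∀ ℓ → toLine (toPoint ℓ) ≡ ℓ
  toLine-toPoint (l₁ x y) = refl
  toLine-toPoint (l₂ x) = refl
  toLine-toPoint l₃ = refl

  toPoint-toLine : ∀ P → toPoint (toLine P) ≡ P
  toPoint-toLine (p₁ x y) = refl
  toPoint-toLine (p₂ x) = refl
  toPoint-toLine p₃ = refl

  toLine-injective : ∀ {P P′} → toLine P ≡ toLine P′ → P ≡ P′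
  toLine-injective {P} {P′} e = trans (sym (toPoint-toLine P)) (trans (cong toPoint e) (toPoint-toLine P′))

  lines-cross-zero⇒≡ : ∀ ℓ ℓ′ → IsZero (cross (lcoords ℓ) (lcoords ℓ′)) → ℓ ≡ ℓ′
  lines-cross-zero⇒≡ ℓ ℓ′ z = begin
    ℓ                          ≡⟨ toLine-toPoint ℓ ⟨
    toLine (toPoint ℓ)         ≡⟨ cong toLine (cross-zero⇒≡ (toPoint ℓ) (toPoint ℓ′)
                                   (subst₂ (λ u v → IsZero (cross u v)) (lcoords-toPoint ℓ) (lcoords-toPoint ℓ′) z)) ⟩
    toLine (toPoint ℓ′)        ≡⟨ toLine-toPoint ℓ′ ⟩
    ℓ′                         ∎
    where
    open ≡-Reasoning
    lcoords-toPoint : ∀ ℓ → lcoords ℓ ≡ pcoords (toPoint ℓ)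
    lcoords-toPoint ℓ = trans (cong lcoords (sym (toLine-toPoint ℓ))) (lcoords-toLine (toPoint ℓ))

  -- The intersection of two lines is the point with coordinates proportional to their cross product.
  meet-point : ∀ ℓ ℓ′ → ℓ ≢ ℓ′ →
    Σ Point (λ X → Incident X ℓ × Incident X ℓ′ × (∀ P → Incident P ℓ → Incident P ℓ′ → X ≡ P))
  meet-point ℓ ℓ′ ℓ≢ℓ′ = X , on-ℓ , on-ℓ′ , unique
    where
    A = lcoords ℓ
    B = lcoords ℓ′
    nm = normalise (cross A B) (λ z → ℓ≢ℓ′ (lines-cross-zero⇒≡ ℓ ℓ′ z))
    X = proj₁ nm
    l = proj₁ (proj₂ nm)
    X≡l·A×B = proj₂ (proj₂ nm)
    on : ∀ U → dot (cross A B) U ≡ 0F → dot (pcoords X) U ≡ 0F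
    on U e = trans (cong (λ t → dot t U) X≡l·A×B) (trans (dot-scale l (cross A B) U) (trans (cong (l *F_) e) (zeroʳ l)))
    on-ℓ = on A (dot-cross-left A B)
    on-ℓ′ = on B (dot-cross-right A B)
    unique : ∀ P → Incident P ℓ → Incident P ℓ′ → X ≡ P
    unique P Pℓ Pℓ′ = cross-zero⇒≡ X P (subst (λ t → IsZero (cross t (pcoords P))) (sym X≡l·A×B)
      (cross-scale-zero l (cross A B) (pcoords P) (cross-cross-zero A B (pcoords P) Pℓ Pℓ′)))

  carrierEnumeration : Enumeration Carrier
  carrierEnumeration = record { _≟_ = _≟F_ ; elements = elems ; complete = elems-complete ; unique = elems-unique }

  module Scalars = EnumerationProperties carrierEnumeration

  zero? : Carrier → Bool
  zero? x = ⌊ x ≟F 0F ⌋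

  zero?-true : ∀ {x} → x ≡ 0F → zero? x ≡ true
  zero?-true {x} x≡0 with x ≟F 0F
  ... | yes _ = refl
  ... | no x≢0 = ⊥-elim (x≢0 x≡0)

  zero?-false : ∀ {x} → x ≢ 0F → zero? x ≡ false
  zero?-false {x} x≢0 with x ≟F 0F
  ... | yes x≡0 = ⊥-elim (x≢0 x≡0)
  ... | no _ = refl

  zero?⇒≡0 : ∀ {x} → zero? x ≡ true → x ≡ 0F
  zero?⇒≡0 {x} h with x ≟F 0F
  ... | yes x≡0 = x≡0

  roots-linear : ∀ α β → β ≢ 0F → count (λ t → zero? (α +F (t *F β))) elems ≡ 1
  roots-linear α β β≢0 = Scalars.count-singleton _ t₀ (zero?-true root) λ t e → unique t (zero?⇒≡0 e)
    where
    open ≡-Reasoning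
    i = inv β
    t₀ = (-F α) *F i
    root : α +F (t₀ *F β) ≡ 0F
    root = begin
      α +F (((-F α) *F i) *F β)     ≡⟨ solve 3 (λ α β i → α :+ :- α :* i :* β := α :+ :- α :* (β :* i)) refl α β i ⟩
      α +F ((-F α) *F (β *F i))     ≡⟨ cong (λ u → α +F ((-F α) *F u)) (inverse β β≢0) ⟩
      α +F ((-F α) *F 1F)           ≡⟨ solve 1 (λ α → α :+ :- α :* con 1ℤ := con 0ℤ) refl α ⟩
      0F                            ∎
    unique : ∀ t → α +F (t *F β) ≡ 0F → t ≡ t₀
    unique t e = begin
      t                                 ≡⟨ *-identityʳ t ⟨
      t *F 1F                           ≡⟨ cong (t *F_) (inverse β β≢0) ⟨
      t *F (β *F i)                     ≡⟨ solve 4 (λ α β i t → t :* (β :* i) := (α :+ t :* β :- α) :* i) refl α β i t ⟩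
      ((α +F (t *F β)) -F α) *F i       ≡⟨ cong (λ u → (u -F α) *F i) e ⟩
      (0F -F α) *F i                    ≡⟨ solve 2 (λ α i → (con 0ℤ :- α) :* i := :- α :* i) refl α i ⟩
      t₀                                ∎

  roots-constant : ∀ α → count (λ t → zero? (α +F (t *F 0F))) elems ≡ q * toℕ (zero? α)
  roots-constant α = trans (count-cong _ (λ _ → zero? α) elems (λ t → cong zero? (trans (cong (α +F_) (zeroʳ t)) (+-identityʳ α))))
                           (constant (zero? α))
    where
    constant : ∀ b → count (λ _ → b) elems ≡ q * toℕ b
    constant true = trans (count-all _ elems (λ _ → refl)) (sym (ℕ.*-identityʳ q))
    constant false = trans (count-none _ elems (λ _ → refl)) (sym (ℕ.*-zeroʳ q))

  2≤q : 2 ≤ q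
  2≤q = subst (_≤ q) two (ℕ.≤-trans (count-mono _ (λ _ → true) elems (λ _ _ → refl)) (ℕ.≤-reflexive (count-all _ elems (λ _ → refl))))
    where
    open ≡-Reasoning
    disjoint : ∀ x → (Scalars.is 0F ∩ Scalars.is 1F) x ≡ false
    disjoint x with x ≟F 0F | x ≟F 1F
    ... | yes refl | yes 0≡1 = ⊥-elim (0≢1 0≡1)
    ... | yes _ | no _ = refl
    ... | no _ | _ = refl
    two : count (Scalars.is 0F ∪ Scalars.is 1F) elems ≡ 2
    two = begin
      count (Scalars.is 0F ∪ Scalars.is 1F) elems
        ≡⟨ ℕ.+-identityʳ _ ⟨
      count (Scalars.is 0F ∪ Scalars.is 1F) elems + 0
        ≡⟨ cong (count (Scalars.is 0F ∪ Scalars.is 1F) elems +_) (count-none _ elems disjoint) ⟨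
      count (Scalars.is 0F ∪ Scalars.is 1F) elems + count (Scalars.is 0F ∩ Scalars.is 1F) elems
        ≡⟨ count-∪+count-∩ (Scalars.is 0F) (Scalars.is 1F) elems ⟩
      count (Scalars.is 0F) elems + count (Scalars.is 1F) elems
        ≡⟨ cong₂ _+_ (Scalars.count-is 0F) (Scalars.count-is 1F) ⟩
      2 ∎

  affinePoints : List Point
  affinePoints = concatMap (λ x → map (p₁ x) elems) elems

  affinePoints≡ : affinePoints ≡ cartesianProductWith p₁ elems elems
  affinePoints≡ = concatMap-map≡cartesianProductWith p₁ elems elems

  allPoints-complete : ∀ P → P ∈ allPoints
  allPoints-complete (p₁ x y) = ∈-++⁺ˡ (subst (p₁ x y ∈_) (sym affinePoints≡)
    (∈-cartesianProductWith⁺ p₁ (elems-complete x) (elems-complete y)))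
  allPoints-complete (p₂ x) = ∈-++⁺ʳ affinePoints (∈-++⁺ˡ (∈-map⁺ p₂ (elems-complete x)))
  allPoints-complete p₃ = ∈-++⁺ʳ affinePoints (∈-++⁺ʳ (map p₂ elems) (here refl))

  allPoints-unique : Unique allPoints
  allPoints-unique = Unique.++⁺ affine-unique (Unique.++⁺ (Unique.map⁺ p₂-injective elems-unique) ([] ∷ []) infinite-disjoint) affine-disjoint
    where
    p₁-injective : ∀ {w x y z} → p₁ w y ≡ p₁ x z → w ≡ x × y ≡ z
    p₁-injective refl = refl , refl
    p₂-injective : ∀ {x y} → p₂ x ≡ p₂ y → x ≡ y
    p₂-injective refl = refl
    affine-unique : Unique affinePoints
    affine-unique = subst Unique (sym affinePoints≡) (Unique.cartesianProductWith⁺ p₁ p₁-injective elems-unique elems-unique)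
    infinite-disjoint : ∀ {P} → ¬ (P ∈ map p₂ elems × P ∈ p₃ ∷ [])
    infinite-disjoint (P∈ , here refl) with ∈-map⁻ p₂ P∈
    ... | _ , _ , ()
    affine-disjoint : ∀ {P} → ¬ (P ∈ affinePoints × P ∈ map p₂ elems ++ p₃ ∷ [])
    affine-disjoint (P∈affine , P∈rest) with ∈-cartesianProductWith⁻ p₁ elems elems (subst (_ ∈_) affinePoints≡ P∈affine)
    affine-disjoint (P∈affine , P∈rest) | _ , _ , _ , _ , refl with ∈-++⁻ (map p₂ elems) P∈rest
    ... | inj₁ P∈infinite with ∈-map⁻ p₂ P∈infinite
    ...   | _ , _ , ()
    affine-disjoint (P∈affine , P∈rest) | _ , _ , _ , _ , refl | inj₂ (here ())

  _≟L_ : DecidableEquality Line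
  ℓ ≟L ℓ′ with toPoint ℓ ≟P toPoint ℓ′
  ... | yes e = yes (trans (sym (toLine-toPoint ℓ)) (trans (cong toLine e) (toLine-toPoint ℓ′)))
  ... | no ne = no (λ e → ne (cong toPoint e))

  allLines≡ : allLines ≡ map toLine allPoints
  allLines≡ = sym (begin
    map toLine (affinePoints ++ (map p₂ elems ++ p₃ ∷ []))
      ≡⟨ List.map-++ toLine affinePoints _ ⟩
    map toLine affinePoints ++ map toLine (map p₂ elems ++ p₃ ∷ [])
      ≡⟨ cong₂ _++_ (trans (List.map-concatMap toLine (λ x → map (p₁ x) elems) elems)
                           (List.concatMap-cong (λ x → sym (List.map-∘ elems)) elems))
                    (trans (List.map-++ toLine (map p₂ elems) (p₃ ∷ [])) (cong (_++ l₃ ∷ []) (sym (List.map-∘ elems)))) ⟩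
    allLines ∎)
    where open ≡-Reasoning

  pointEnumeration : Enumeration Point
  pointEnumeration = record { _≟_ = _≟P_ ; elements = allPoints ; complete = allPoints-complete ; unique = allPoints-unique }

  lineEnumeration : Enumeration Line
  lineEnumeration = record
    { _≟_ = _≟L_
    ; elements = allLines
    ; complete = λ ℓ → subst (ℓ ∈_) (sym allLines≡) (subst (_∈ map toLine allPoints) (toLine-toPoint ℓ)
                         (∈-map⁺ toLine (allPoints-complete (toPoint ℓ))))
    ; unique = subst Unique (sym allLines≡) (Unique.map⁺ toLine-injective allPoints-unique)
    }

  module Points = EnumerationProperties pointEnumeration

  count-allPoints : ∀ p → count p allPoints ≡
    sum (map (λ x → count (λ y → p (p₁ x y)) elems) elems) + (count (λ x → p (p₂ x)) elems + toℕ (p p₃))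
  count-allPoints p = begin
    count p (affinePoints ++ (map p₂ elems ++ p₃ ∷ []))
      ≡⟨ count-++ p affinePoints _ ⟩
    count p affinePoints + count p (map p₂ elems ++ p₃ ∷ [])
      ≡⟨ cong₂ _+_ (trans (count-concatMap p (λ x → map (p₁ x) elems) elems) (sum-map-cong _ _ elems λ x → count-map p (p₁ x) elems))
                   (trans (count-++ p (map p₂ elems) (p₃ ∷ []))
                          (cong₂ _+_ (count-map p p₂ elems) (trans (count-∷ p p₃ []) (ℕ.+-identityʳ _)))) ⟩
    sum (map (λ x → count (λ y → p (p₁ x y)) elems) elems) + (count (λ x → p (p₂ x)) elems + toℕ (p p₃)) ∎
    where open ≡-Reasoning

  allPoints-count : length allPoints ≡ suc (q + q * q)
  allPoints-count = begin
    length allPoints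
      ≡⟨ count-all (λ _ → true) allPoints (λ _ → refl) ⟨
    count (λ _ → true) allPoints
      ≡⟨ count-allPoints (λ _ → true) ⟩
    sum (map (λ x → count (λ _ → true) elems) elems) + (count (λ _ → true) elems + 1)
      ≡⟨ cong₂ (λ a b → a + (b + 1)) (sum-map-const _ q elems (λ _ → all)) all ⟩
    q * q + (q + 1)
      ≡⟨ arithmetic q ⟩
    suc (q + q * q) ∎
    where
    open ≡-Reasoning
    all : count (λ _ → true) elems ≡ q
    all = count-all _ elems (λ _ → refl)
    arithmetic : ∀ q → q * q + (q + 1) ≡ suc (q + q * q)
    arithmetic = solve-∀

  -- The points (1, x, y), (0, 1, x) and (0, 0, 1) are counted separately; in each family the
  -- equation c · P = 0 is linear in the last coordinate.
  points-on : ∀ c → ¬ IsZero c → count (λ P → zero? (dot (pcoords P) c)) allPoints ≡ suc q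
  points-on ⟨ c₀ , c₁ , c₂ ⟩ c≢0 = trans (count-allPoints _) (by-cases (c₂ ≟F 0F))
    where
    open ≡-Reasoning
    vertical : ((0F *F c₀) +F (0F *F c₁)) +F (1F *F c₂) ≡ c₂
    vertical = solve 3 (λ a b c → con 0ℤ :* a :+ con 0ℤ :* b :+ con 1ℤ :* c := c) refl c₀ c₁ c₂
    infinite : (0F *F c₀) +F (1F *F c₁) ≡ c₁
    infinite = solve 2 (λ a b → con 0ℤ :* a :+ con 1ℤ :* b := b) refl c₀ c₁
    by-cases : Dec (c₂ ≡ 0F) →
      sum (map (λ x → count (λ y → zero? (((1F *F c₀) +F (x *F c₁)) +F (y *F c₂))) elems) elems)
        + (count (λ x → zero? (((0F *F c₀) +F (1F *F c₁)) +F (x *F c₂))) elems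
           + toℕ (zero? (((0F *F c₀) +F (0F *F c₁)) +F (1F *F c₂))))
      ≡ suc q
    by-cases (no c₂≢0) = begin
      _ ≡⟨ cong₂ (λ a b → a + (b + toℕ (zero? (((0F *F c₀) +F (0F *F c₁)) +F (1F *F c₂)))))
                 (sum-map-const _ 1 elems (λ x → roots-linear _ c₂ c₂≢0)) (roots-linear _ c₂ c₂≢0) ⟩
      1 * q + (1 + toℕ (zero? (((0F *F c₀) +F (0F *F c₁)) +F (1F *F c₂))))
        ≡⟨ cong (λ b → 1 * q + (1 + toℕ b)) (zero?-false (λ e → c₂≢0 (trans (sym vertical) e))) ⟩
      1 * q + (1 + 0)
        ≡⟨ arithmetic q ⟩
      suc q ∎
      where
      arithmetic : ∀ q → 1 * q + (1 + 0) ≡ suc q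
      arithmetic = solve-∀
    by-cases (yes refl) = begin
      _ ≡⟨ cong₂ (λ a b → a + (b + toℕ (zero? (((0F *F c₀) +F (0F *F c₁)) +F (1F *F 0F)))))
                 (trans (sum-map-cong _ _ elems (λ x → roots-constant _)) (sum-map-scaled-toℕ q _ elems)) (roots-constant _) ⟩
      q * count (λ x → zero? ((1F *F c₀) +F (x *F c₁))) elems
        + (q * toℕ (zero? ((0F *F c₀) +F (1F *F c₁))) + toℕ (zero? (((0F *F c₀) +F (0F *F c₁)) +F (1F *F 0F))))
        ≡⟨ cong (λ b → q * count (λ x → zero? ((1F *F c₀) +F (x *F c₁))) elems + (q * toℕ (zero? ((0F *F c₀) +F (1F *F c₁))) + toℕ b))
                (zero?-true vertical) ⟩
      q * count (λ x → zero? ((1F *F c₀) +F (x *F c₁))) elems + (q * toℕ (zero? ((0F *F c₀) +F (1F *F c₁))) + 1)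
        ≡⟨ finite-part (c₁ ≟F 0F) ⟩
      suc q ∎
      where
      finite-part : Dec (c₁ ≡ 0F) →
        q * count (λ x → zero? ((1F *F c₀) +F (x *F c₁))) elems + (q * toℕ (zero? ((0F *F c₀) +F (1F *F c₁))) + 1) ≡ suc q
      finite-part (no c₁≢0) = begin
        _ ≡⟨ cong₂ (λ a b → q * a + (q * toℕ b + 1)) (roots-linear _ c₁ c₁≢0) (zero?-false (λ e → c₁≢0 (trans (sym infinite) e))) ⟩
        q * 1 + (q * 0 + 1) ≡⟨ arithmetic q ⟩
        suc q ∎
        where
        arithmetic : ∀ q → q * 1 + (q * 0 + 1) ≡ suc q
        arithmetic = solve-∀
      finite-part (yes refl) = begin
        _ ≡⟨ cong₂ (λ a b → q * a + (q * toℕ b + 1)) (roots-constant (1F *F c₀)) (zero?-true infinite) ⟩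
        q * (q * toℕ (zero? (1F *F c₀))) + (q * 1 + 1)
          ≡⟨ cong (λ b → q * (q * toℕ b) + (q * 1 + 1)) (zero?-false (λ e → c≢0 (trans (sym (*-identityˡ c₀)) e , refl , refl))) ⟩
        q * (q * 0) + (q * 1 + 1) ≡⟨ arithmetic q ⟩
        suc q ∎
        where
        arithmetic : ∀ q → q * (q * 0) + (q * 1 + 1) ≡ suc q
        arithmetic = solve-∀

  lcoords-nonzero : ∀ ℓ → ¬ IsZero (lcoords ℓ)
  lcoords-nonzero (l₁ x y) (1≡0 , _ , _) = 1≢0 1≡0
  lcoords-nonzero (l₂ x) (_ , 1≡0 , _) = 1≢0 1≡0
  lcoords-nonzero l₃ (_ , _ , 1≡0) = 1≢0 1≡0

  line-size : ∀ ℓ → count (λ P → incident? P ℓ) allPoints ≡ suc q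
  line-size ℓ = points-on (lcoords ℓ) (lcoords-nonzero ℓ)

  lines-meet-once : ∀ ℓ ℓ′ → ℓ ≢ ℓ′ → count ((λ P → incident? P ℓ) ∩ (λ P → incident? P ℓ′)) allPoints ≡ 1
  lines-meet-once ℓ ℓ′ ℓ≢ℓ′ = Points.count-singleton _ X (∧-intro (zero?-true Xℓ) (zero?-true Xℓ′))
    λ P e → let (Pℓ , Pℓ′) = ∧-true e in sym (unique P (zero?⇒≡0 Pℓ) (zero?⇒≡0 Pℓ′))
    where
    X = proj₁ (meet-point ℓ ℓ′ ℓ≢ℓ′)
    Xℓ = proj₁ (proj₂ (meet-point ℓ ℓ′ ℓ≢ℓ′))
    Xℓ′ = proj₁ (proj₂ (proj₂ (meet-point ℓ ℓ′ ℓ≢ℓ′)))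
    unique = proj₂ (proj₂ (proj₂ (meet-point ℓ ℓ′ ℓ≢ℓ′)))

  incident?-toLine : ∀ P X → incident? P (toLine X) ≡ incident? X (toLine P)
  incident?-toLine P X = cong zero? (begin
    dot (pcoords P) (lcoords (toLine X))   ≡⟨ cong (dot (pcoords P)) (lcoords-toLine X) ⟩
    dot (pcoords P) (pcoords X)            ≡⟨ dot-comm (pcoords P) (pcoords X) ⟩
    dot (pcoords X) (pcoords P)            ≡⟨ cong (dot (pcoords X)) (lcoords-toLine P) ⟨
    dot (pcoords X) (lcoords (toLine P))   ∎)
    where open ≡-Reasoning

  count-allLines : ∀ p → count p allLines ≡ count (λ X → p (toLine X)) allPoints
  count-allLines p = trans (cong (count p) allLines≡) (count-map p toLine allPoints)

  pencil-size : ∀ P → count (incident? P) allLines ≡ suc q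
  pencil-size P = trans (count-allLines _) (trans (count-cong _ _ allPoints (incident?-toLine P)) (line-size (toLine P)))

  points-join-once : ∀ P P′ → P ≢ P′ → count (incident? P ∩ incident? P′) allLines ≡ 1
  points-join-once P P′ P≢P′ = trans (count-allLines _)
    (trans (count-cong _ _ allPoints (λ X → cong₂ _∧_ (incident?-toLine P X) (incident?-toLine P′ X)))
           (lines-meet-once (toLine P) (toLine P′) (λ e → P≢P′ (toLine-injective e))))

  plane : ProjectivePlane
  plane = record
    { Point = Point ; Line = Line
    ; pointEnumeration = pointEnumeration ; lineEnumeration = lineEnumeration
    ; incident? = incident? ; Incident = Incident
    ; Incident⇒incident? = zero?-true ; incident?⇒Incident = zero?⇒≡0
    ; q = q ; 2≤q = 2≤q ; points-count = allPoints-count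
    ; line-size = line-size ; pencil-size = pencil-size
    ; lines-meet-once = lines-meet-once ; points-join-once = points-join-once
    }

theorem7p3 : (K : FiniteField) → let open PG K in
    ((L : ℕ) → 2 ≤ L → L ≤ q → (G : Point) (ls : List Line) →
    length ls ≡ L → Unique ls → All (Incident G) ls →
    (size (unionOfLines ls) ≡ 1 + L * q)
    × IsOptimalSaturating (unionOfLines ls) ((L C 2) * q))
    × ((G : Point) (ls : List Line) (m : Line) (B : List Point) →
    length ls ≡ q → Unique ls → All (Incident G) ls →
    Incident G m → m ∉ ls →
    1 ≤ length B → length B ≤ q ∸ 1 → Unique B →
    All (λ P → Incident P m × P ≢ G) B →
    (size (λ P → unionOfLines ls P ∨ inList B P) ≡ 1 + q ^ 2 + length B)
    × IsOptimalSaturating (λ P → unionOfLines ls P ∨ inList B P)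
    (((length B + 1) C 2) + (q C 2) * q))
    × ((ℓ₁ ℓ₂ ℓ₃ : Line) → NonConcurrent ℓ₁ ℓ₂ ℓ₃ →
    (size (triangle ℓ₁ ℓ₂ ℓ₃) ≡ 3 * q)
    × IsOptimalSaturating (triangle ℓ₁ ℓ₂ ℓ₃) (3 * (q ∸ 1)))
    × ((ℓ₁ ℓ₂ ℓ₃ : Line) → NonConcurrent ℓ₁ ℓ₂ ℓ₃ →
    (size (λ P → not (vertexlessTriangle ℓ₁ ℓ₂ ℓ₃ P)) ≡ q ^ 2 ∸ 2 * q + 4)
    × IsOptimalSaturating (λ P → not (vertexlessTriangle ℓ₁ ℓ₂ ℓ₃ P))
    (1 + (q C 2) + (q ∸ 1) * ((q ∸ 2) C 2)))
theorem7p3 K = concurrent-lines-optimal , pencil-with-points-optimal , triangle-optimal , vertexless-triangle-complement-optimal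
  where open PlaneGeometry (ProjectiveCoordinates.plane K)
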